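{- Let $n$ and $k$ be integers with $n\ge 2k+1$ and $k\ge 3$. Then $ex_{\mathcal{P}}(n,C_k)\ge ex_{\mathcal{P}}(n-k,C_k)+3k-6$.
   Context: All graphs are finite and simple. $C_k$ denotes the cycle on $k$ vertices. For a graph $H$, $ex_{\mathcal{P}}(n,H)$ is the maximum number of edges in a planar graph on $n$ vertices that does not contain $H$ as a subgraph. -}

module Defs where

open import Data.Nat using (ℕ; zero; suc; _≤_; _<ᵇ_)
open import Data.Fin using (Fin; zero; suc; toℕ; inject₁; fromℕ)
open import Data.Bool using (Bool; true; false; _∧_; if_then_else_)
open import Data.List using (List; map; concatMap; allFin)
open import Data.Nat.ListAction using (sum)
open import Data.Rational using (ℚ; 0ℚ; 1ℚ; _+_; _*_; _-_)
open import Data.Rational using () renaming (_≤_ to _≤ℚ_)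
open import Data.Product using (Σ; _×_; _,_)
open import Data.Sum using (_⊎_)
open import Data.Empty using (⊥)
open import Relation.Nullary using (¬_)
open import Relation.Binary.PropositionalEquality using (_≡_)
open import Function.Definitions using (Injective)

record Graph (n : ℕ) : Set where
  field
    adj   : Fin n → Fin n → Bool
    sym   : ∀ i j → adj i j ≡ adj j i
    irref : ∀ i → adj i i ≡ false
open Graph public

edgeCount : ∀ {n} → Graph n → ℕ
edgeCount {n} G =
  sum (concatMap (λ i → map (λ j → if adj G i j ∧ (toℕ i <ᵇ toℕ j) then 1 else 0)
                             (allFin n))
                 (allFin n))

ContainsCycle : (k : ℕ) → ∀ {n} → Graph n → Set
ContainsCycle zero    G = ⊥
ContainsCycle (suc m) {n} G =
  Σ (Fin (suc m) → Fin n) λ f →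
    Injective _≡_ _≡_ f
    × (∀ (i : Fin m) → adj G (f (inject₁ i)) (f (suc i)) ≡ true)
    × adj G (f (fromℕ m)) (f zero) ≡ true

Point : Set
Point = ℚ × ℚ

OnSegment : Point → Point → Point → Set
OnSegment (ax , ay) (bx , by) (qx , qy) =
  Σ ℚ λ t → (0ℚ ≤ℚ t) × (t ≤ℚ 1ℚ)
    × (qx ≡ ax + t * (bx - ax)) × (qy ≡ ay + t * (by - ay))

record PlaneDrawing {n : ℕ} (G : Graph n) : Set where
  field
    pos       : Fin n → Point
    pos-inj   : Injective _≡_ _≡_ pos
    no-vertex-on-edge : ∀ u v w → adj G u v ≡ true → ¬ (w ≡ u) → ¬ (w ≡ v) →
                        ¬ OnSegment (pos u) (pos v) (pos w)
    edges-meet-at-ends : ∀ u v x y → adj G u v ≡ true → adj G x y ≡ true →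
                         ¬ (u ≡ x × v ≡ y) → ¬ (u ≡ y × v ≡ x) →
                         ∀ q → OnSegment (pos u) (pos v) q → OnSegment (pos x) (pos y) q →
                         Σ (Fin n) λ w → (w ≡ u ⊎ w ≡ v) × (w ≡ x ⊎ w ≡ y) × (q ≡ pos w)

-- Planar graph: admits a plane straight-line drawing (Fáry's theorem; rational
-- coordinates suffice by perturbation).
Planar : ∀ {n} → Graph n → Set
Planar G = PlaneDrawing G

IsExP : (n k m : ℕ) → Set
IsExP n k m =
  (Σ (Graph n) λ G → Planar G × ¬ ContainsCycle k G × edgeCount G ≡ m)
  × (∀ (G : Graph n) → Planar G → ¬ ContainsCycle k G → edgeCount G ≤ m)

-- Take a C_k-free plane graph G on n − k vertices with ex_P(n − k, C_k) edges and glue a gadget on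
-- k new vertices to a rightmost vertex v of G. Numbering the gadget 0 (= v), 1, …, k: vertex 0 is joined
-- to all others, vertex 1 to 4, …, k, these form a path, and 23 is an edge when k ≥ 4. This gives 3k − 6
-- new edges. Drawn with 0 at the origin, 1 at (2, 0) and c ≥ 2 at (1, c), the gadget lies to the right
-- of v, so the union is still plane. A cycle through the cut vertex v stays within G or within one block
-- of the gadget, {0, 1, 4, …, k} or {0, 2, 3} (for k = 3 each block is a single edge), and all these
-- blocks have fewer than k vertices.
module Submission where

open import Defs hiding (sym)
open import Data.Nat.Base using (ℕ; zero; suc)
open import Data.Fin.Base using (Fin; toℕ)
open import Data.Bool.Base using (Bool; true; false)
open import Data.Product using (Σ; _×_; _,_; proj₁; proj₂)
open import Data.Sum using (_⊎_; inj₁; inj₂; [_,_]′)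
import Data.Sum as Sum
open import Data.Empty using (⊥; ⊥-elim)
open import Function using (_∘_; id; const)
open import Relation.Nullary using (¬_; yes; no)
open import Relation.Binary.PropositionalEquality

false≢true : false ≢ true
false≢true ()

module Counting where
  open import Data.Nat.Base using (_+_; _≤_; _<_; _<ᵇ_; _≡ᵇ_; z≤n)
  import Data.Nat.Properties as ℕ
  open import Data.Nat.ListAction using () renaming (sum to listSum)
  open import Data.Nat.ListAction.Properties using (sum-++)
  open import Algebra.Properties.CommutativeMonoid.Sum ℕ.+-0-commutativeMonoid public
    using (sum; sum-syntax; sum-cong-≗; ∑-distrib-+; sum-replicate-zero)
  open import Data.Fin.Base using (zero; suc; _↑ˡ_; _↑ʳ_)
  open import Data.Bool.Base using (_∧_; if_then_else_)
  open import Data.Bool.Properties using (∧-zeroʳ)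
  open import Data.List.Base using (List; []; _∷_; map; concatMap; tabulate)
  open import Relation.Nullary.Decidable using (dec-true)

  upperEdge : ∀ {n} → Graph n → Fin n → Fin n → ℕ
  upperEdge G i j = if adj G i j ∧ (toℕ i <ᵇ toℕ j) then 1 else 0

  sum-mono-≤ : ∀ {n} {f g : Fin n → ℕ} → (∀ i → f i ≤ g i) → sum f ≤ sum g
  sum-mono-≤ {zero}  f≤g = z≤n
  sum-mono-≤ {suc n} f≤g = ℕ.+-mono-≤ (f≤g zero) (sum-mono-≤ (f≤g ∘ suc))

  term≤sum : ∀ {n} (f : Fin n → ℕ) i → f i ≤ sum f
  term≤sum f zero    = ℕ.m≤m+n (f zero) _
  term≤sum f (suc i) = ℕ.≤-trans (term≤sum (f ∘ suc) i) (ℕ.m≤n+m _ (f zero))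

  sum-splitAt : ∀ m {k} (f : Fin (m + k) → ℕ) → sum f ≡ sum (f ∘ (_↑ˡ k)) + sum (f ∘ (m ↑ʳ_))
  sum-splitAt zero    f = refl
  sum-splitAt (suc m) f = trans (cong (f zero +_) (sum-splitAt m (f ∘ suc))) (sym (ℕ.+-assoc (f zero) _ _))

  sum-ones : ∀ n → ∑[ i < n ] 1 ≡ n
  sum-ones zero    = refl
  sum-ones (suc n) = cong suc (sum-ones n)

  sum-point : ∀ n a → ∑[ d < n ] (if toℕ d ≡ᵇ a then 1 else 0) ≡ (if a <ᵇ n then 1 else 0)
  sum-point zero    a       = refl
  sum-point (suc n) zero    = cong suc (sum-replicate-zero n)
  sum-point (suc n) (suc a) = sum-point n a

  sum-below-last : ∀ n → ∑[ e < suc n ] (if toℕ e <ᵇ n then 1 else 0) ≡ n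
  sum-below-last zero    = refl
  sum-below-last (suc n) = cong suc (sum-below-last n)

  listSum-tabulate : ∀ {n} {A : Set} (h : A → ℕ) (g : Fin n → A) →
                     listSum (map h (tabulate g)) ≡ ∑[ i < n ] h (g i)
  listSum-tabulate {zero}  h g = refl
  listSum-tabulate {suc n} h g = cong (h (g zero) +_) (listSum-tabulate h (g ∘ suc))

  listSum-concatMap : ∀ {A : Set} (g : A → List ℕ) xs →
                      listSum (concatMap g xs) ≡ listSum (map (listSum ∘ g) xs)
  listSum-concatMap g []       = refl
  listSum-concatMap g (x ∷ xs) =
    trans (sum-++ (g x) (concatMap g xs)) (cong (listSum (g x) +_) (listSum-concatMap g xs))

  edgeCount-∑ : ∀ {n} (G : Graph n) → edgeCount G ≡ ∑[ i < n ] ∑[ j < n ] upperEdge G i j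
  edgeCount-∑ {n} G = begin
    edgeCount G
      ≡⟨ listSum-concatMap row (tabulate id) ⟩
    listSum (map (listSum ∘ row) (tabulate id))
      ≡⟨ listSum-tabulate (listSum ∘ row) id ⟩
    ∑[ i < n ] listSum (row i)
      ≡⟨ sum-cong-≗ (λ i → listSum-tabulate (upperEdge G i) id) ⟩
    ∑[ i < n ] ∑[ j < n ] upperEdge G i j ∎
    where
    open ≡-Reasoning
    row : Fin n → List ℕ
    row i = map (upperEdge G i) (tabulate id)

  edgeCount-splitAt : ∀ {m k} (G : Graph (m + k)) → edgeCount G ≡
    ∑[ u < m ] (∑[ w < m ] upperEdge G (u ↑ˡ k) (w ↑ˡ k) + ∑[ j < k ] upperEdge G (u ↑ˡ k) (m ↑ʳ j)) +
    ∑[ i < k ] (∑[ w < m ] upperEdge G (m ↑ʳ i) (w ↑ˡ k) + ∑[ j < k ] upperEdge G (m ↑ʳ i) (m ↑ʳ j))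
  edgeCount-splitAt {m} {k} G = trans (edgeCount-∑ G)
    (trans (sum-splitAt m (λ x → ∑[ y < m + k ] upperEdge G x y))
           (cong₂ _+_ (sum-cong-≗ {m} λ u → sum-splitAt m (upperEdge G (u ↑ˡ k)))
                      (sum-cong-≗ {k} λ i → sum-splitAt m (upperEdge G (m ↑ʳ i)))))

  upperEdge-to-zero : ∀ {n} (G : Graph (suc n)) c → upperEdge G c zero ≡ 0
  upperEdge-to-zero G c = cong (if_then 1 else 0) (∧-zeroʳ (adj G c zero))

  edgeCount-split-zero : ∀ {k} (Q : Graph (suc k)) → edgeCount Q ≡
    ∑[ j < k ] upperEdge Q zero (suc j) + ∑[ i < k ] ∑[ j < k ] upperEdge Q (suc i) (suc j)
  edgeCount-split-zero {k} Q = trans (edgeCount-∑ Q)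
    (cong₂ _+_ (cong (_+ ∑[ j < k ] upperEdge Q zero (suc j)) (upperEdge-to-zero Q zero))
               (sum-cong-≗ λ i → cong (_+ ∑[ j < k ] upperEdge Q (suc i) (suc j)) (upperEdge-to-zero Q (suc i))))

  +-<ᵇ : ∀ m {a b} → (m + a <ᵇ m + b) ≡ (a <ᵇ b)
  +-<ᵇ zero    = refl
  +-<ᵇ (suc m) = +-<ᵇ m

  <⇒<ᵇ≡true : ∀ {a b} → a < b → (a <ᵇ b) ≡ true
  <⇒<ᵇ≡true {a} {b} a<b = dec-true (a ℕ.<? b) a<b

module Cycles where
  open import Data.Nat.Base using (_≤_; _<_; z≤n; s≤s)
  import Data.Nat.Properties as ℕ
  open import Data.Fin.Base using (zero; suc; inject₁; fromℕ; punchOut)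
  import Data.Fin.Properties as Fin
  open import Function.Definitions using (Injective)
  open import Relation.Binary.Definitions using (tri<; tri≈; tri>)

  IsWalk : ∀ {N l} → Graph N → (Fin (suc l) → Fin N) → Set
  IsWalk {l = l} G g = ∀ (i : Fin l) → adj G (g (inject₁ i)) (g (suc i)) ≡ true

  cycle-transfer : ∀ {N M n} (H : Graph N) (G : Graph M) (S : Fin N → Set) (ρ : Fin N → Fin M) →
                   (∀ {x y} → S x → S y → ρ x ≡ ρ y → x ≡ y) →
                   (∀ {x y} → S x → S y → adj H x y ≡ true → adj G (ρ x) (ρ y) ≡ true) →
                   (C : ContainsCycle (suc n) H) → (∀ i → S (proj₁ C i)) → ContainsCycle (suc n) G
  cycle-transfer H G S ρ ρ-inj ρ-adj (f , inj , walk , wrap) inS =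
    ρ ∘ f , (λ e → inj (ρ-inj (inS _) (inS _) e)) , (λ i → ρ-adj (inS _) (inS _) (walk i)) ,
    ρ-adj (inS _) (inS _) wrap

  injection-avoiding-two : ∀ {m n} (f : Fin m → Fin (suc (suc n))) → Injective _≡_ _≡_ f →
                           ∀ {a b} → a ≢ b → (∀ i → f i ≢ a) → (∀ i → f i ≢ b) → m ≤ n
  injection-avoiding-two f f-inj {a} {b} a≢b f≢a f≢b = Fin.injective⇒≤ h-inj
    where
    g : Fin _ → Fin _
    g i = punchOut (≢-sym (f≢a i))
    g≢b : ∀ i → g i ≢ punchOut a≢b
    g≢b i e = f≢b i (Fin.punchOut-injective (≢-sym (f≢a i)) a≢b e)
    h : Fin _ → Fin _
    h i = punchOut (≢-sym (g≢b i))
    h-inj : Injective _≡_ _≡_ h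
    h-inj {i} {j} e = f-inj (Fin.punchOut-injective (≢-sym (f≢a i)) (≢-sym (f≢a j))
                               (Fin.punchOut-injective (≢-sym (g≢b i)) (≢-sym (g≢b j)) e))

  module _ {N} (Gr : Graph N) (c : Fin N) {A : Set} (colour : Fin N → A)
           (separates : ∀ x y → adj Gr x y ≡ true → x ≢ c → y ≢ c → colour x ≡ colour y) where

    colour-prefix : ∀ {l} (g : Fin (suc l) → Fin N) → IsWalk Gr g →
                    ∀ i → (∀ j → toℕ j ≤ toℕ i → g j ≢ c) → colour (g i) ≡ colour (g zero)
    colour-prefix g walk zero    avoid = refl
    colour-prefix {suc l} g walk (suc i) avoid =
      trans (colour-prefix (g ∘ suc) (walk ∘ suc) i (λ j j≤i → avoid (suc j) (s≤s j≤i)))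
            (sym (separates _ _ (walk zero) (avoid zero z≤n) (avoid (suc zero) (s≤s z≤n))))

    colour-suffix : ∀ {l} (g : Fin (suc l) → Fin N) → IsWalk Gr g →
                    ∀ i → (∀ j → toℕ i ≤ toℕ j → g j ≢ c) → colour (g i) ≡ colour (g (fromℕ l))
    colour-suffix {zero}  g walk zero    avoid = refl
    colour-suffix {suc l} g walk zero    avoid =
      trans (separates _ _ (walk zero) (avoid zero z≤n) (avoid (suc zero) z≤n))
            (colour-suffix (g ∘ suc) (walk ∘ suc) zero (λ j _ → avoid (suc j) z≤n))
    colour-suffix {suc l} g walk (suc i) avoid =
      colour-suffix (g ∘ suc) (walk ∘ suc) i (λ j i≤j → avoid (suc j) (s≤s i≤j))

    -- The cycle passes c at most once, so deleting c leaves a single walk.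
    cycle-monochromatic : ∀ {n} (C : ContainsCycle (suc n) Gr) → ∀ i j →
                          proj₁ C i ≢ c → proj₁ C j ≢ c → colour (proj₁ C i) ≡ colour (proj₁ C j)
    cycle-monochromatic {n} (f , inj , walk , wrap) i j fi≢c fj≢c with Fin.any? (λ p → f p Fin.≟ c)
    ... | no c∉f = trans (to-start i) (sym (to-start j))
      where
      to-start : ∀ i → colour (f i) ≡ colour (f zero)
      to-start i = colour-prefix f walk i (λ j _ e → c∉f (j , e))
    ... | yes (p , fp≡c) = combine (side i fi≢c) (side j fj≢c)
      where
      off-p : ∀ {j} → toℕ j ≢ toℕ p → f j ≢ c
      off-p ne e = ne (cong toℕ (inj (trans e (sym fp≡c))))

      side : ∀ i → f i ≢ c → toℕ i < toℕ p ⊎ toℕ p < toℕ i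
      side i fi≢c with ℕ.<-cmp (toℕ i) (toℕ p)
      ... | tri< lt _ _ = inj₁ lt
      ... | tri≈ _ eq _ = ⊥-elim (fi≢c (trans (cong f (Fin.toℕ-injective eq)) fp≡c))
      ... | tri> _ _ gt = inj₂ gt

      before : ∀ i → toℕ i < toℕ p → colour (f i) ≡ colour (f zero)
      before i i<p = colour-prefix f walk i (λ j j≤i → off-p (ℕ.<⇒≢ (ℕ.≤-<-trans j≤i i<p)))

      after : ∀ i → toℕ p < toℕ i → colour (f i) ≡ colour (f (fromℕ n))
      after i p<i = colour-suffix f walk i (λ j i≤j → off-p (ℕ.>⇒≢ (ℕ.<-≤-trans p<i i≤j)))

      across : ∀ i j → toℕ i < toℕ p → toℕ p < toℕ j → colour (f i) ≡ colour (f j)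
      across i j i<p p<j = begin
        colour (f i)          ≡⟨ before i i<p ⟩
        colour (f zero)       ≡⟨ sym (separates _ _ wrap last≢c zero≢c) ⟩
        colour (f (fromℕ n))  ≡⟨ sym (after j p<j) ⟩
        colour (f j)          ∎
        where
        open ≡-Reasoning
        zero≢c : f zero ≢ c
        zero≢c = off-p (ℕ.<⇒≢ (ℕ.≤-<-trans z≤n i<p))
        last≢c : f (fromℕ n) ≢ c
        last≢c = off-p (ℕ.>⇒≢ (subst (toℕ p <_) (sym (Fin.toℕ-fromℕ n))
                                      (ℕ.<-≤-trans p<j (Fin.toℕ≤pred[n] j))))

      combine : toℕ i < toℕ p ⊎ toℕ p < toℕ i → toℕ j < toℕ p ⊎ toℕ p < toℕ j →
                colour (f i) ≡ colour (f j)
      combine (inj₁ i<p) (inj₁ j<p) = trans (before i i<p) (sym (before j j<p))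
      combine (inj₁ i<p) (inj₂ p<j) = across i j i<p p<j
      combine (inj₂ p<i) (inj₁ j<p) = sym (across j i j<p p<i)
      combine (inj₂ p<i) (inj₂ p<j) = trans (after i p<i) (sym (after j p<j))

-- The one-point union of G and Q, identifying the vertex v of G with the vertex zero of Q.
module Glue {m k : ℕ} (G : Graph m) (v : Fin m) (Q : Graph (suc k)) where
  open import Data.Nat.Base using (_+_; _≤_; _<ᵇ_)
  import Data.Nat.Properties as ℕ
  open import Data.Fin.Base using (zero; suc; _↑ˡ_; _↑ʳ_; splitAt)
  import Data.Fin.Properties as Fin
  open import Data.Bool.Base using (_∧_)
  open import Data.Bool.Properties using (∧-conicalˡ; ∧-conicalʳ) renaming (_≟_ to _≟ᵇ_)
  open import Relation.Nullary using (does)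
  open import Relation.Nullary.Decidable using (dec-true)
  open Counting
  open Cycles

  old : Fin m → Fin (m + k)
  old u = u ↑ˡ k

  new : Fin k → Fin (m + k)
  new j = m ↑ʳ j

  fromQ : Fin (suc k) → Fin (m + k)
  fromQ zero    = old v
  fromQ (suc j) = new j

  isV : Fin m → Bool
  isV u = does (u Fin.≟ v)

  isV-v : isV v ≡ true
  isV-v = dec-true (v Fin.≟ v) refl

  isV⇒≡v : ∀ {u} → isV u ≡ true → u ≡ v
  isV⇒≡v {u} e with u Fin.≟ v
  ... | yes u≡v = u≡v

  adj⊎ : Fin m ⊎ Fin k → Fin m ⊎ Fin k → Bool
  adj⊎ (inj₁ u) (inj₁ w) = adj G u w
  adj⊎ (inj₁ u) (inj₂ j) = isV u ∧ adj Q zero (suc j)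
  adj⊎ (inj₂ i) (inj₁ w) = isV w ∧ adj Q (suc i) zero
  adj⊎ (inj₂ i) (inj₂ j) = adj Q (suc i) (suc j)

  adj⊎-sym : ∀ x y → adj⊎ x y ≡ adj⊎ y x
  adj⊎-sym (inj₁ u) (inj₁ w) = Graph.sym G u w
  adj⊎-sym (inj₁ u) (inj₂ j) = cong (isV u ∧_) (Graph.sym Q zero (suc j))
  adj⊎-sym (inj₂ i) (inj₁ w) = cong (isV w ∧_) (Graph.sym Q (suc i) zero)
  adj⊎-sym (inj₂ i) (inj₂ j) = Graph.sym Q (suc i) (suc j)

  adj⊎-irrefl : ∀ x → adj⊎ x x ≡ false
  adj⊎-irrefl (inj₁ u) = irref G u
  adj⊎-irrefl (inj₂ j) = irref Q (suc j)

  glued : Graph (m + k)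
  glued = record
    { adj   = λ x y → adj⊎ (splitAt m x) (splitAt m y)
    ; sym   = λ x y → adj⊎-sym (splitAt m x) (splitAt m y)
    ; irref = λ x → adj⊎-irrefl (splitAt m x)
    }

  data View : Fin (m + k) → Set where
    is-old : ∀ u → View (old u)
    is-new : ∀ j → View (new j)

  view : ∀ x → View x
  view x with splitAt m x in eq
  ... | inj₁ u = subst View (Fin.splitAt⁻¹-↑ˡ eq) (is-old u)
  ... | inj₂ j = subst View (Fin.splitAt⁻¹-↑ʳ eq) (is-new j)

  splitAt-old : ∀ u → splitAt m (old u) ≡ inj₁ u
  splitAt-old u = Fin.splitAt-↑ˡ m u k

  splitAt-new : ∀ j → splitAt m (new j) ≡ inj₂ j
  splitAt-new j = Fin.splitAt-↑ʳ m k j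

  adj-old-old : ∀ u w → adj glued (old u) (old w) ≡ adj G u w
  adj-old-old u w rewrite splitAt-old u | splitAt-old w = refl

  adj-old-new : ∀ u j → adj glued (old u) (new j) ≡ isV u ∧ adj Q zero (suc j)
  adj-old-new u j rewrite splitAt-old u | splitAt-new j = refl

  adj-new-old : ∀ i w → adj glued (new i) (old w) ≡ isV w ∧ adj Q (suc i) zero
  adj-new-old i w rewrite splitAt-old w | splitAt-new i = refl

  adj-new-new : ∀ i j → adj glued (new i) (new j) ≡ adj Q (suc i) (suc j)
  adj-new-new i j rewrite splitAt-new i | splitAt-new j = refl

  adj-fromQ : ∀ c d → adj glued (fromQ c) (fromQ d) ≡ adj Q c d
  adj-fromQ zero    zero    = trans (adj-old-old v v) (trans (irref G v) (sym (irref Q zero)))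
  adj-fromQ zero    (suc j) = trans (adj-old-new v j) (cong (_∧ _) isV-v)
  adj-fromQ (suc i) zero    = trans (adj-new-old i v) (cong (_∧ _) isV-v)
  adj-fromQ (suc i) (suc j) = adj-new-new i j

  InG InQ : Fin (m + k) → Set
  InG x = Σ (Fin m) λ u → x ≡ old u
  InQ x = Σ (Fin (suc k)) λ c → x ≡ fromQ c

  GlueEdge : Fin (m + k) → Fin (m + k) → Set
  GlueEdge x y = (Σ (Fin m) λ u → Σ (Fin m) λ w → x ≡ old u × y ≡ old w × adj G u w ≡ true)
               ⊎ (Σ (Fin (suc k)) λ c → Σ (Fin (suc k)) λ d → x ≡ fromQ c × y ≡ fromQ d × adj Q c d ≡ true)

  glued-edge : ∀ x y → adj glued x y ≡ true → GlueEdge x y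
  glued-edge x y = go (view x) (view y)
    where
    go : ∀ {x y} → View x → View y → adj glued x y ≡ true → GlueEdge x y
    go (is-old u) (is-old w) e = inj₁ (u , w , refl , refl , trans (sym (adj-old-old u w)) e)
    go (is-old u) (is-new j) e = let e′ = trans (sym (adj-old-new u j)) e in
      inj₂ (zero , suc j , cong old (isV⇒≡v (∧-conicalˡ _ _ e′)) , refl , ∧-conicalʳ _ _ e′)
    go (is-new i) (is-old w) e = let e′ = trans (sym (adj-new-old i w)) e in
      inj₂ (suc i , zero , refl , cong old (isV⇒≡v (∧-conicalˡ _ _ e′)) , ∧-conicalʳ _ _ e′)
    go (is-new i) (is-new j) e = inj₂ (suc i , suc j , refl , refl , trans (sym (adj-new-new i j)) e)

  toG : Fin (m + k) → Fin m
  toG x = [ id , const v ]′ (splitAt m x)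

  toQ : Fin (m + k) → Fin (suc k)
  toQ x = [ const zero , suc ]′ (splitAt m x)

  isNew : Fin (m + k) → Bool
  isNew x = [ const false , const true ]′ (splitAt m x)

  toG-old : ∀ u → toG (old u) ≡ u
  toG-old u rewrite splitAt-old u = refl

  toQ-fromQ : ∀ c → toQ (fromQ c) ≡ c
  toQ-fromQ zero    rewrite splitAt-old v = refl
  toQ-fromQ (suc j) rewrite splitAt-new j = refl

  isNew-old : ∀ u → isNew (old u) ≡ false
  isNew-old u rewrite splitAt-old u = refl

  isNew-new : ∀ j → isNew (new j) ≡ true
  isNew-new j rewrite splitAt-new j = refl

  v-separates : ∀ x y → adj glued x y ≡ true → x ≢ old v → y ≢ old v → isNew x ≡ isNew y
  v-separates x y e x≢v y≢v with glued-edge x y e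
  ... | inj₁ (u , w , refl , refl , _) = trans (isNew-old u) (sym (isNew-old w))
  ... | inj₂ (zero  , d     , refl , _ , _) = ⊥-elim (x≢v refl)
  ... | inj₂ (suc i , zero  , _ , refl , _) = ⊥-elim (y≢v refl)
  ... | inj₂ (suc i , suc j , refl , refl , _) = trans (isNew-new i) (sym (isNew-new j))

  glued-cycle : ∀ K → ContainsCycle K glued → ContainsCycle K G ⊎ ContainsCycle K Q
  glued-cycle zero    ()
  glued-cycle (suc n) C@(f , _) with Fin.any? (λ p → isNew (f p) ≟ᵇ true)
  ... | yes (p , fp-new) = inj₂ (cycle-transfer glued Q InQ toQ toQ-inj toQ-adj C inQ)
    where
    toQ-inj : ∀ {x y} → InQ x → InQ y → toQ x ≡ toQ y → x ≡ y
    toQ-inj (c , refl) (d , refl) e =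
      cong fromQ (trans (sym (toQ-fromQ c)) (trans e (toQ-fromQ d)))
    toQ-adj : ∀ {x y} → InQ x → InQ y → adj glued x y ≡ true → adj Q (toQ x) (toQ y) ≡ true
    toQ-adj (c , refl) (d , refl) e rewrite toQ-fromQ c | toQ-fromQ d = trans (sym (adj-fromQ c d)) e
    fp≢v : f p ≢ old v
    fp≢v e = false≢true (trans (sym (isNew-old v)) (trans (cong isNew (sym e)) fp-new))
    inQ : ∀ i → InQ (f i)
    inQ i with f i Fin.≟ old v
    ... | yes fi≡v = zero , fi≡v
    ... | no fi≢v = new-in-Q (view (f i))
          (trans (cycle-monochromatic glued (old v) isNew v-separates C i p fi≢v fp≢v) fp-new)
      where
      new-in-Q : ∀ {x} → View x → isNew x ≡ true → InQ x
      new-in-Q (is-old u) x-new = ⊥-elim (false≢true (trans (sym (isNew-old u)) x-new))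
      new-in-Q (is-new j) _     = suc j , refl
  ... | no no-new = inj₁ (cycle-transfer glued G InG toG toG-inj toG-adj C inG)
    where
    toG-inj : ∀ {x y} → InG x → InG y → toG x ≡ toG y → x ≡ y
    toG-inj (u , refl) (w , refl) e = cong old (trans (sym (toG-old u)) (trans e (toG-old w)))
    toG-adj : ∀ {x y} → InG x → InG y → adj glued x y ≡ true → adj G (toG x) (toG y) ≡ true
    toG-adj (u , refl) (w , refl) e rewrite toG-old u | toG-old w = trans (sym (adj-old-old u w)) e
    inG : ∀ i → InG (f i)
    inG i = not-new-in-G (view (f i)) (λ x-new → no-new (i , x-new))
      where
      not-new-in-G : ∀ {x} → View x → isNew x ≢ true → InG x
      not-new-in-G (is-old u) _      = u , refl
      not-new-in-G (is-new j) ¬x-new = ⊥-elim (¬x-new (isNew-new j))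

  upperEdge-old : ∀ u w → upperEdge glued (old u) (old w) ≡ upperEdge G u w
  upperEdge-old u w rewrite adj-old-old u w | Fin.toℕ-↑ˡ u k | Fin.toℕ-↑ˡ w k = refl

  upperEdge-new : ∀ c j → upperEdge glued (fromQ c) (new j) ≡ upperEdge Q c (suc j)
  upperEdge-new zero j rewrite adj-old-new v j | isV-v | Fin.toℕ-↑ˡ v k | Fin.toℕ-↑ʳ m j
    | <⇒<ᵇ≡true (ℕ.<-≤-trans (Fin.toℕ<n v) (ℕ.m≤m+n m (toℕ j))) = refl
  upperEdge-new (suc i) j rewrite adj-new-new i j | Fin.toℕ-↑ʳ m i | Fin.toℕ-↑ʳ m j
    | +-<ᵇ m {toℕ i} {toℕ j} = refl

  glued-edgeCount : edgeCount G + edgeCount Q ≤ edgeCount glued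
  glued-edgeCount = begin
    edgeCount G + edgeCount Q
      ≡⟨ cong₂ _+_ (edgeCount-∑ G) countQ ⟩
    edgesG + (spokes + edgesQ)
      ≡⟨ sym (ℕ.+-assoc edgesG spokes edgesQ) ⟩
    edgesG + spokes + edgesQ
      ≤⟨ ℕ.+-mono-≤ (ℕ.+-mono-≤ (ℕ.≤-reflexive (sum-cong-≗ λ u → sum-cong-≗ λ w → sym (upperEdge-old u w)))
                                (term≤sum (λ u → ∑[ j < k ] e (old u) (new j)) v))
                    (sum-mono-≤ λ i → ℕ.m≤n+m (∑[ j < k ] e (new i) (new j)) (∑[ w < m ] e (new i) (old w))) ⟩
    ∑[ u < m ] ∑[ w < m ] e (old u) (old w) + ∑[ u < m ] ∑[ j < k ] e (old u) (new j)
      + ∑[ i < k ] (∑[ w < m ] e (new i) (old w) + ∑[ j < k ] e (new i) (new j))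
      ≡⟨ cong (_+ ∑[ i < k ] row (new i)) (sym (∑-distrib-+ (λ u → ∑[ w < m ] e (old u) (old w))
                                                             (λ u → ∑[ j < k ] e (old u) (new j)))) ⟩
    ∑[ u < m ] row (old u) + ∑[ i < k ] row (new i)
      ≡⟨ sym (edgeCount-splitAt {m} {k} glued) ⟩
    edgeCount glued ∎
    where
    open ℕ.≤-Reasoning
    e : Fin (m + k) → Fin (m + k) → ℕ
    e = upperEdge glued
    row : Fin (m + k) → ℕ
    row x = ∑[ w < m ] e x (old w) + ∑[ j < k ] e x (new j)
    edgesG spokes edgesQ : ℕ
    edgesG = ∑[ u < m ] ∑[ w < m ] upperEdge G u w
    spokes = ∑[ j < k ] e (old v) (new j)
    edgesQ = ∑[ i < k ] ∑[ j < k ] e (new i) (new j)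
    countQ : edgeCount Q ≡ spokes + edgesQ
    countQ = trans (edgeCount-split-zero Q)
                   (sym (cong₂ _+_ (sum-cong-≗ (upperEdge-new zero))
                                   (sum-cong-≗ λ i → sum-cong-≗ (upperEdge-new (suc i)))))

module Plane where
  open import Data.Rational
    using (ℚ; 0ℚ; 1ℚ; _+_; _*_; _-_; -_; _≤_; _<_; _≟_; _<?_; 1/_; NonZero; ≢-nonZero; nonNegative)
  open import Data.Rational.Properties
  open import Data.Rational.Solver using (module +-*-Solver)
  open +-*-Solver
  open import Relation.Nullary.Decidable using (toWitness)
  open import Data.Nat.Base using (suc)
  open import Data.Fin.Base using (zero; suc)
  open import Data.List.Base using (allFin)
  import Data.List.Relation.Unary.All as All
  open import Data.List.Membership.Propositional.Properties using (∈-allFin)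
  open import Relation.Binary.Bundles using (DecTotalOrder)
  open PlaneDrawing using (pos)
  open import Data.List.Extrema (DecTotalOrder.totalOrder ≤-decTotalOrder) using (argmax; f[xs]≤f[argmax])

  0≤_≤1 : ℚ → Set
  0≤ t ≤1 = 0ℚ ≤ t × t ≤ 1ℚ

  0<1 : 0ℚ < 1ℚ
  0<1 = toWitness {a? = 0ℚ <? 1ℚ} _

  0≤1 : 0ℚ ≤ 1ℚ
  0≤1 = <⇒≤ 0<1

  p≤q⇒0≤q-p : ∀ {p q} → p ≤ q → 0ℚ ≤ q - p
  p≤q⇒0≤q-p {p} {q} p≤q = subst (_≤ q - p) (+-inverseʳ p) (+-monoˡ-≤ (- p) p≤q)

  0≤q-p⇒p≤q : ∀ {p q} → 0ℚ ≤ q - p → p ≤ q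
  0≤q-p⇒p≤q {p} {q} 0≤q-p = subst₂ _≤_ (+-identityˡ p) (solve 2 (λ p q → q :- p :+ p := q) refl p q)
                                    (+-monoˡ-≤ p 0≤q-p)

  p-q≡0⇒p≡q : ∀ {p q} → p - q ≡ 0ℚ → p ≡ q
  p-q≡0⇒p≡q {p} {q} e =
    trans (solve 2 (λ p q → p := q :+ (p :- q)) refl p q) (trans (cong (q +_) e) (+-identityʳ q))

  +-cancelˡ-≡ : ∀ p {q r} → p + q ≡ p + r → q ≡ r
  +-cancelˡ-≡ p {q} {r} e = trans (sym (cancel q)) (trans (cong ((- p) +_) e) (cancel r))
    where
    cancel : ∀ s → (- p) + (p + s) ≡ s
    cancel s = solve 2 (λ p s → (:- p) :+ (p :+ s) := s) refl p s

  +-cancelˡ-≤ : ∀ p {q r} → p + q ≤ p + r → q ≤ r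
  +-cancelˡ-≤ p {q} {r} le = subst₂ _≤_ (cancel q) (cancel r) (+-monoʳ-≤ (- p) le)
    where
    cancel : ∀ s → (- p) + (p + s) ≡ s
    cancel s = solve 2 (λ p s → (:- p) :+ (p :+ s) := s) refl p s

  0≤p*q : ∀ {p q} → 0ℚ ≤ p → 0ℚ ≤ q → 0ℚ ≤ p * q
  0≤p*q {p} {q} 0≤p 0≤q =
    nonNegative⁻¹ _ {{nonNeg*nonNeg⇒nonNeg p {{nonNegative 0≤p}} q {{nonNegative 0≤q}}}}

  p*q≡0 : ∀ {p q} → p * q ≡ 0ℚ → p ≡ 0ℚ ⊎ q ≡ 0ℚ
  p*q≡0 {p} {q} e with p ≟ 0ℚ
  ... | yes p≡0 = inj₁ p≡0
  ... | no p≢0 = inj₂ (begin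
    q                ≡⟨ sym (*-identityˡ q) ⟩
    1ℚ * q           ≡⟨ cong (_* q) (sym (*-inverseˡ p)) ⟩
    (1/ p) * p * q   ≡⟨ *-assoc (1/ p) p q ⟩
    (1/ p) * (p * q) ≡⟨ cong ((1/ p) *_) e ⟩
    (1/ p) * 0ℚ      ≡⟨ *-zeroʳ (1/ p) ⟩
    0ℚ               ∎)
    where
    open ≡-Reasoning
    instance
      p-nonZero : NonZero p
      p-nonZero = ≢-nonZero p≢0

  nonNeg-sum≤0 : ∀ {p q} → 0ℚ ≤ p → 0ℚ ≤ q → p + q ≤ 0ℚ → p ≡ 0ℚ × q ≡ 0ℚ
  nonNeg-sum≤0 {p} {q} 0≤p 0≤q p+q≤0 =
    ≤-antisym (≤-trans (subst (_≤ p + q) (+-identityʳ p) (+-monoʳ-≤ p 0≤q)) p+q≤0) 0≤p ,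
    ≤-antisym (≤-trans (subst (_≤ p + q) (+-identityˡ q) (+-monoˡ-≤ q 0≤p)) p+q≤0) 0≤q

  -- a + t (b - a) = (1 - t) a + t b
  convex-≤ : ∀ {t a b X} → 0≤ t ≤1 → a ≤ X → b ≤ X → a + t * (b - a) ≤ X
  convex-≤ {t} {a} {b} {X} (0≤t , t≤1) a≤X b≤X = 0≤q-p⇒p≤q (subst (0ℚ ≤_) e
    (subst (_≤ (1ℚ - t) * (X - a) + t * (X - b)) (+-identityʳ 0ℚ)
      (+-mono-≤ (0≤p*q (p≤q⇒0≤q-p t≤1) (p≤q⇒0≤q-p a≤X)) (0≤p*q 0≤t (p≤q⇒0≤q-p b≤X)))))
    where
    e : (1ℚ - t) * (X - a) + t * (X - b) ≡ X - (a + t * (b - a))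
    e = solve 4 (λ X a b t → (con 1ℚ :- t) :* (X :- a) :+ t :* (X :- b) := X :- (a :+ t :* (b :- a)))
              refl X a b t

  OnSegment-sym : ∀ a b {q} → OnSegment a b q → OnSegment b a q
  OnSegment-sym (ax , ay) (bx , by) (t , 0≤t , t≤1 , ex , ey) =
    1ℚ - t , p≤q⇒0≤q-p t≤1 , 1-t≤1 , trans ex (reverse ax bx) , trans ey (reverse ay by)
    where
    reverse : ∀ a b → a + t * (b - a) ≡ b + (1ℚ - t) * (a - b)
    reverse a b = solve 3 (λ t a b → a :+ t :* (b :- a) := b :+ (con 1ℚ :- t) :* (a :- b)) refl t a b
    1-t≤1 : 1ℚ - t ≤ 1ℚ
    1-t≤1 = 0≤q-p⇒p≤q (subst (0ℚ ≤_) (solve 1 (λ t → t := con 1ℚ :- (con 1ℚ :- t)) refl t) 0≤t)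

  OnSegment-start : ∀ a b → OnSegment a b a
  OnSegment-start (ax , ay) (bx , by) = 0ℚ , ≤-refl , 0≤1 , start ax bx , start ay by
    where
    start : ∀ a b → a ≡ a + 0ℚ * (b - a)
    start a b = solve 2 (λ a b → a := a :+ con 0ℚ :* (b :- a)) refl a b

  OnSegment-cong : ∀ {a a′ b b′ q q′} → a ≡ a′ → b ≡ b′ → q ≡ q′ → OnSegment a b q → OnSegment a′ b′ q′
  OnSegment-cong refl refl refl seg = seg

  _⊕_ _⊖_ : Point → Point → Point
  (ax , ay) ⊕ (bx , by) = ax + bx , ay + by
  (ax , ay) ⊖ (bx , by) = ax - bx , ay - by

  ⊕-identityʳ : ∀ o → o ⊕ (0ℚ , 0ℚ) ≡ o
  ⊕-identityʳ (ox , oy) = cong₂ _,_ (+-identityʳ ox) (+-identityʳ oy)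

  ⊕-⊖ : ∀ o p → (o ⊕ p) ⊖ o ≡ p
  ⊕-⊖ (ox , oy) (px , py) = cong₂ _,_ (law ox px) (law oy py)
    where
    law : ∀ o p → o + p - o ≡ p
    law = solve 2 (λ o p → o :+ p :- o := p) refl

  ⊖-⊕ : ∀ o q → o ⊕ (q ⊖ o) ≡ q
  ⊖-⊕ (ox , oy) (qx , qy) = cong₂ _,_ (law ox qx) (law oy qy)
    where
    law : ∀ o q → o + (q - o) ≡ q
    law = solve 2 (λ o q → o :+ (q :- o) := q) refl

  ⊕-cancelˡ : ∀ o {p q} → o ⊕ p ≡ o ⊕ q → p ≡ q
  ⊕-cancelˡ o {p} {q} e = trans (sym (⊕-⊖ o p)) (trans (cong (_⊖ o) e) (⊕-⊖ o q))

  OnSegment-translate : ∀ o {a b q} → OnSegment (o ⊕ a) (o ⊕ b) q → OnSegment a b (q ⊖ o)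
  OnSegment-translate (ox , oy) {ax , ay} {bx , by} (t , 0≤t , t≤1 , ex , ey) =
    t , 0≤t , t≤1 , trans (cong (_- ox) ex) (law ox ax bx t) , trans (cong (_- oy) ey) (law oy ay by t)
    where
    law : ∀ o a b t → o + a + t * ((o + b) - (o + a)) - o ≡ a + t * (b - a)
    law = solve 4 (λ o a b t → o :+ a :+ t :* ((o :+ b) :- (o :+ a)) :- o := a :+ t :* (b :- a)) refl

  IsRightmost : ∀ {n} {G : Graph n} → PlaneDrawing G → Fin n → Set
  IsRightmost {n} D v = ∀ u → proj₁ (pos D u) ≤ proj₁ (pos D v)

  rightmost-vertex : ∀ {n} {G : Graph n} (D : PlaneDrawing G) → Fin n → Σ (Fin n) (IsRightmost D)
  rightmost-vertex {n} D u₀ =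
    argmax x u₀ (allFin n) , λ u → All.lookup (f[xs]≤f[argmax] u₀ (allFin n)) (∈-allFin u)
    where
    x : Fin n → ℚ
    x = proj₁ ∘ pos D

  record RightOfOrigin {k} {Q : Graph (suc k)} (D : PlaneDrawing Q) : Set where
    field
      zero-at-origin : pos D zero ≡ (0ℚ , 0ℚ)
      others-right   : ∀ j → 0ℚ < proj₁ (pos D (suc j))
      edges-right    : ∀ c d q → adj Q c d ≡ true → OnSegment (pos D c) (pos D d) q →
                       0ℚ ≤ proj₁ q × (proj₁ q ≡ 0ℚ → q ≡ (0ℚ , 0ℚ) × (c ≡ zero ⊎ d ≡ zero))

module Fan where
  open import Data.Nat.Base using (ℕ; zero; suc)
  import Data.Nat.Properties as ℕ
  open import Data.Rational using (ℚ; 0ℚ; 1ℚ; _+_; _*_; _-_; _≤_; _<_; _<?_)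
  open import Data.Rational.Properties
  open import Data.Rational.Solver using (module +-*-Solver)
  open +-*-Solver
  open import Relation.Nullary.Decidable using (toWitness)
  open Plane

  fromℕ : ℕ → ℚ
  fromℕ zero    = 0ℚ
  fromℕ (suc n) = fromℕ n + 1ℚ

  0≤fromℕ : ∀ n → 0ℚ ≤ fromℕ n
  0≤fromℕ zero    = ≤-refl
  0≤fromℕ (suc n) = subst (_≤ fromℕ n + 1ℚ) (+-identityʳ 0ℚ) (+-mono-≤ (0≤fromℕ n) 0≤1)

  0<fromℕ-suc : ∀ n → 0ℚ < fromℕ (suc n)
  0<fromℕ-suc n = <-≤-trans 0<1 (subst (_≤ fromℕ n + 1ℚ) (+-identityˡ 1ℚ) (+-monoˡ-≤ 1ℚ (0≤fromℕ n)))

  SameUnitPoint : ℕ → ℕ → ℚ → ℚ → Set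
  SameUnitPoint a b t s =
    (a ≡ b × t ≡ s) ⊎ (b ≡ suc a × t ≡ 1ℚ × s ≡ 0ℚ) ⊎ (a ≡ suc b × t ≡ 0ℚ × s ≡ 1ℚ)

  unit-overflow : ∀ b {t s} → 0≤ t ≤1 → 0≤ s ≤1 → t ≡ fromℕ (suc b) + s →
                  b ≡ 0 × t ≡ 1ℚ × s ≡ 0ℚ
  unit-overflow b {t} {s} (_ , t≤1) (0≤s , _) e = fromℕ≡0 b (proj₁ rest≡0) , t≡1 , proj₂ rest≡0
    where
    e′ : t ≡ 1ℚ + (fromℕ b + s)
    e′ = trans e (solve 2 (λ f s → f :+ con 1ℚ :+ s := con 1ℚ :+ (f :+ s)) refl (fromℕ b) s)
    rest≡0 : fromℕ b ≡ 0ℚ × s ≡ 0ℚ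
    rest≡0 = nonNeg-sum≤0 (0≤fromℕ b) 0≤s
               (+-cancelˡ-≤ 1ℚ (subst₂ _≤_ e′ (sym (+-identityʳ 1ℚ)) t≤1))
    t≡1 : t ≡ 1ℚ
    t≡1 = trans e′ (trans (cong (1ℚ +_) (trans (cong₂ _+_ (proj₁ rest≡0) (proj₂ rest≡0)) (+-identityʳ 0ℚ)))
                          (+-identityʳ 1ℚ))
    fromℕ≡0 : ∀ n → fromℕ n ≡ 0ℚ → n ≡ 0
    fromℕ≡0 zero    _ = refl
    fromℕ≡0 (suc n) e = ⊥-elim (<-irrefl (sym e) (0<fromℕ-suc n))

  same-unit-point : ∀ a b {t s} → 0≤ t ≤1 → 0≤ s ≤1 → fromℕ a + t ≡ fromℕ b + s → SameUnitPoint a b t s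
  same-unit-point zero    zero    {t} {s} ut us e = inj₁ (refl , +-cancelˡ-≡ 0ℚ {t} {s} e)
  same-unit-point zero    (suc b) {t} {s} ut us e =
    let b≡0 , t≡1 , s≡0 = unit-overflow b ut us (trans (sym (+-identityˡ t)) e)
    in inj₂ (inj₁ (cong suc b≡0 , t≡1 , s≡0))
  same-unit-point (suc a) zero    {t} {s} ut us e =
    let a≡0 , s≡1 , t≡0 = unit-overflow a us ut (trans (sym (+-identityˡ s)) (sym e))
    in inj₂ (inj₂ (cong suc a≡0 , t≡0 , s≡1))
  same-unit-point (suc a) (suc b) {t} {s} ut us e =
    lift (same-unit-point a b ut us (+-cancelˡ-≡ 1ℚ {fromℕ a + t} {fromℕ b + s}
           (trans (shift (fromℕ a) t) (trans e (sym (shift (fromℕ b) s))))))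
    where
    shift : ∀ f t → 1ℚ + (f + t) ≡ f + 1ℚ + t
    shift = solve 2 (λ f t → con 1ℚ :+ (f :+ t) := f :+ con 1ℚ :+ t) refl
    lift : SameUnitPoint a b t s → SameUnitPoint (suc a) (suc b) t s
    lift (inj₁ (a≡b , t≡s))               = inj₁ (cong suc a≡b , t≡s)
    lift (inj₂ (inj₁ (b≡1+a , t≡1 , s≡0))) = inj₂ (inj₁ (cong suc b≡1+a , t≡1 , s≡0))
    lift (inj₂ (inj₂ (a≡1+b , t≡0 , s≡1))) = inj₂ (inj₂ (cong suc a≡1+b , t≡0 , s≡1))

  two : ℚ
  two = 1ℚ + 1ℚ

  1<two : 1ℚ < two
  1<two = toWitness {a? = 1ℚ <? two} _

  height : ℕ → ℚ
  height c = fromℕ (suc (suc c))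

  0<height : ∀ c → 0ℚ < height c
  0<height c = 0<fromℕ-suc (suc c)

  height-injective : ∀ {c c′} → height c ≡ height c′ → c ≡ c′
  height-injective {c} {c′} e =
    from (same-unit-point (suc (suc c)) (suc (suc c′)) (≤-refl , 0≤1) (≤-refl , 0≤1) (cong (_+ 0ℚ) e))
    where
    from : SameUnitPoint (suc (suc c)) (suc (suc c′)) 0ℚ 0ℚ → c ≡ c′
    from (inj₁ (e′ , _))              = ℕ.suc-injective (ℕ.suc-injective e′)
    from (inj₂ (inj₁ (_ , 0≡1 , _))) = ⊥-elim (<-irrefl 0≡1 0<1)
    from (inj₂ (inj₂ (_ , _ , 0≡1))) = ⊥-elim (<-irrefl 0≡1 0<1)

  fanPos : ℕ → Point
  fanPos zero          = 0ℚ , 0ℚ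
  fanPos (suc zero)    = two , 0ℚ
  fanPos (suc (suc c)) = 1ℚ , height c

  fanPos-injective : ∀ {a b} → fanPos a ≡ fanPos b → a ≡ b
  fanPos-injective {zero}          {zero}          e = refl
  fanPos-injective {zero}          {suc zero}      e = ⊥-elim (<-irrefl (cong proj₁ e) (<-trans 0<1 1<two))
  fanPos-injective {zero}          {suc (suc b)}   e = ⊥-elim (<-irrefl (cong proj₁ e) 0<1)
  fanPos-injective {suc zero}      {zero}          e = ⊥-elim (<-irrefl (cong proj₁ (sym e)) (<-trans 0<1 1<two))
  fanPos-injective {suc zero}      {suc zero}      e = refl
  fanPos-injective {suc zero}      {suc (suc b)}   e = ⊥-elim (<-irrefl (cong proj₁ (sym e)) 1<two)
  fanPos-injective {suc (suc a)}   {zero}          e = ⊥-elim (<-irrefl (cong proj₁ (sym e)) 0<1)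
  fanPos-injective {suc (suc a)}   {suc zero}      e = ⊥-elim (<-irrefl (cong proj₁ e) 1<two)
  fanPos-injective {suc (suc a)}   {suc (suc b)}   e = cong {A = ℕ} (λ x → suc (suc x)) (height-injective (cong proj₂ e))

  data FanEdge : ℕ → ℕ → Set where
    base  : FanEdge 0 1
    left  : ∀ c → FanEdge 0 (suc (suc c))
    right : ∀ c → FanEdge 1 (suc (suc c))
    spine : ∀ c → FanEdge (suc (suc c)) (suc (suc (suc c)))

  FanAdjacent : ℕ → ℕ → Set
  FanAdjacent a b = FanEdge a b ⊎ FanEdge b a

  edgePoint : ∀ {a b} → FanEdge a b → ℚ → Point
  edgePoint base      t = t * two , 0ℚ
  edgePoint (left c)  t = t , t * height c
  edgePoint (right c) t = two - t , t * height c
  edgePoint (spine c) t = 1ℚ , height c + t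

  onFanEdge : ∀ {a b q} (e : FanEdge a b) → OnSegment (fanPos a) (fanPos b) q →
              Σ ℚ λ t → 0≤ t ≤1 × q ≡ edgePoint e t
  onFanEdge base (t , 0≤t , t≤1 , ex , ey) = t , (0≤t , t≤1) ,
    cong₂ _,_ (trans ex (solve 1 (λ t → con 0ℚ :+ t :* (con two :- con 0ℚ) := t :* con two) refl t))
              (trans ey (solve 1 (λ t → con 0ℚ :+ t :* (con 0ℚ :- con 0ℚ) := con 0ℚ) refl t))
  onFanEdge (left c) (t , 0≤t , t≤1 , ex , ey) = t , (0≤t , t≤1) ,
    cong₂ _,_ (trans ex (solve 1 (λ t → con 0ℚ :+ t :* (con 1ℚ :- con 0ℚ) := t) refl t))
              (trans ey (solve 2 (λ t h → con 0ℚ :+ t :* (h :- con 0ℚ) := t :* h) refl t (height c)))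
  onFanEdge (right c) (t , 0≤t , t≤1 , ex , ey) = t , (0≤t , t≤1) ,
    cong₂ _,_ (trans ex (solve 1 (λ t → con two :+ t :* (con 1ℚ :- con two) := con two :- t) refl t))
              (trans ey (solve 2 (λ t h → con 0ℚ :+ t :* (h :- con 0ℚ) := t :* h) refl t (height c)))
  onFanEdge (spine c) (t , 0≤t , t≤1 , ex , ey) = t , (0≤t , t≤1) ,
    cong₂ _,_ (trans ex (solve 1 (λ t → con 1ℚ :+ t :* (con 1ℚ :- con 1ℚ) := con 1ℚ) refl t))
              (trans ey (solve 2 (λ t h → h :+ t :* (h :+ con 1ℚ :- h) := h :+ t) refl t (height c)))

  edgePoint-start : ∀ {a b t} (e : FanEdge a b) → t ≡ 0ℚ → edgePoint e t ≡ fanPos a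
  edgePoint-start {t = t} e t≡0 = trans (cong (edgePoint e) t≡0) (start e)
    where
    start : ∀ {a b} (e : FanEdge a b) → edgePoint e 0ℚ ≡ fanPos a
    start base      = cong₂ _,_ (*-zeroˡ two) refl
    start (left c)  = cong₂ _,_ refl (*-zeroˡ (height c))
    start (right c) = cong₂ _,_ (solve 0 (con two :- con 0ℚ := con two) refl) (*-zeroˡ (height c))
    start (spine c) = cong₂ _,_ refl (+-identityʳ (height c))

  edgePoint-end : ∀ {a b t} (e : FanEdge a b) → t ≡ 1ℚ → edgePoint e t ≡ fanPos b
  edgePoint-end {t = t} e t≡1 = trans (cong (edgePoint e) t≡1) (end e)
    where
    end : ∀ {a b} (e : FanEdge a b) → edgePoint e 1ℚ ≡ fanPos b
    end base      = cong₂ _,_ (*-identityˡ two) refl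
    end (left c)  = cong₂ _,_ refl (*-identityˡ (height c))
    end (right c) = cong₂ _,_ (solve 0 (con two :- con 1ℚ := con 1ℚ) refl) (*-identityˡ (height c))
    end (spine c) = refl

  t*height≡0 : ∀ {t} c → t * height c ≡ 0ℚ → t ≡ 0ℚ
  t*height≡0 c e = [ (λ t≡0 → t≡0) , (λ h≡0 → ⊥-elim (<-irrefl (sym h≡0) (0<height c))) ]′ (p*q≡0 e)

  t*height-injective : ∀ {t c c′} → c ≢ c′ → t * height c ≡ t * height c′ → t ≡ 0ℚ
  t*height-injective {t} {c} {c′} c≢c′ e =
    [ (λ t≡0 → t≡0) , (λ d≡0 → ⊥-elim (c≢c′ (height-injective (p-q≡0⇒p≡q d≡0)))) ]′ (p*q≡0 t*d≡0)
    where
    t*d≡0 : t * (height c - height c′) ≡ 0ℚ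
    t*d≡0 = trans (solve 3 (λ t h h′ → t :* (h :- h′) := t :* h :- t :* h′) refl t (height c) (height c′))
                  (trans (cong (_- t * height c′) e) (+-inverseʳ (t * height c′)))

  0<height+ : ∀ c {s} → 0ℚ ≤ s → 0ℚ < height c + s
  0<height+ c {s} 0≤s = subst (_< height c + s) (+-identityʳ 0ℚ) (+-mono-<-≤ (0<height c) 0≤s)

  two-minus-injective : ∀ {t s} → two - t ≡ two - s → t ≡ s
  two-minus-injective {t} {s} e = trans (back t) (trans (cong (two -_) e) (sym (back s)))
    where
    back : ∀ t → t ≡ two - (two - t)
    back t = solve 1 (λ t → t := con two :- (con two :- t)) refl t

  two-minus≡1 : ∀ {t} → two - t ≡ 1ℚ → t ≡ 1ℚ
  two-minus≡1 e = two-minus-injective (trans e (solve 0 (con 1ℚ := con two :- con 1ℚ) refl))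

  unit+unit≡two : ∀ {t s} → 0≤ t ≤1 → 0≤ s ≤1 → t ≡ two - s → t ≡ 1ℚ × s ≡ 1ℚ
  unit+unit≡two {t} {s} (_ , t≤1) (_ , s≤1) e =
    sym (p-q≡0⇒p≡q (proj₁ both≡0)) , sym (p-q≡0⇒p≡q (proj₂ both≡0))
    where
    slack≡0 : (1ℚ - t) + (1ℚ - s) ≡ 0ℚ
    slack≡0 = trans (cong (λ t → (1ℚ - t) + (1ℚ - s)) e)
                    (solve 1 (λ s → (con 1ℚ :- (con two :- s)) :+ (con 1ℚ :- s) := con 0ℚ) refl s)
    both≡0 : 1ℚ - t ≡ 0ℚ × 1ℚ - s ≡ 0ℚ
    both≡0 = nonNeg-sum≤0 (p≤q⇒0≤q-p t≤1) (p≤q⇒0≤q-p s≤1) (≤-reflexive slack≡0)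

  spine-vertex : ∀ {c c′ s} → 0≤ s ≤1 → height c ≡ height c′ + s → c ≡ c′ ⊎ c ≡ suc c′
  spine-vertex {c} {c′} us e =
    from (same-unit-point (suc (suc c)) (suc (suc c′)) (≤-refl , 0≤1) us (trans (+-identityʳ (height c)) e))
    where
    from : SameUnitPoint (suc (suc c)) (suc (suc c′)) 0ℚ _ → c ≡ c′ ⊎ c ≡ suc c′
    from (inj₁ (e′ , _))              = inj₁ (ℕ.suc-injective (ℕ.suc-injective e′))
    from (inj₂ (inj₁ (_ , 0≡1 , _))) = ⊥-elim (<-irrefl 0≡1 0<1)
    from (inj₂ (inj₂ (e′ , _ , _)))   = inj₂ (ℕ.suc-injective (ℕ.suc-injective e′))

  MeetAtEnd : ℕ → ℕ → ℕ → ℕ → Point → Set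
  MeetAtEnd a b c d q = Σ ℕ λ w → (w ≡ a ⊎ w ≡ b) × (w ≡ c ⊎ w ≡ d) × q ≡ fanPos w

  1*height : ∀ {t} c → t ≡ 1ℚ → t * height c ≡ height c
  1*height c t≡1 = trans (cong (_* height c) t≡1) (*-identityˡ (height c))

  module _ {t s : ℚ} (ut : 0≤ t ≤1) (us : 0≤ s ≤1) where

    meet-base-left : ∀ c → edgePoint base t ≡ edgePoint (left c) s →
                     MeetAtEnd 0 1 0 (suc (suc c)) (edgePoint base t)
    meet-base-left c p =
      0 , inj₁ refl , inj₁ refl , trans p (edgePoint-start {t = s} (left c) (t*height≡0 {s} c (sym (cong proj₂ p))))

    meet-base-right : ∀ c → edgePoint base t ≡ edgePoint (right c) s →
                      MeetAtEnd 0 1 1 (suc (suc c)) (edgePoint base t)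
    meet-base-right c p =
      1 , inj₂ refl , inj₁ refl , trans p (edgePoint-start {t = s} (right c) (t*height≡0 {s} c (sym (cong proj₂ p))))

    meet-base-spine : ∀ c → edgePoint base t ≢ edgePoint (spine c) s
    meet-base-spine c p = <-irrefl (cong proj₂ p) (0<height+ c (proj₁ us))

    meet-left-left : ∀ c c′ → c ≢ c′ → edgePoint (left c) t ≡ edgePoint (left c′) s →
                     MeetAtEnd 0 (suc (suc c)) 0 (suc (suc c′)) (edgePoint (left c) t)
    meet-left-left c c′ c≢c′ p = 0 , inj₁ refl , inj₁ refl , edgePoint-start (left c) t≡0
      where
      t≡0 = t*height-injective {t} c≢c′ (trans (cong proj₂ p) (cong (_* height c′) (sym (cong proj₁ p))))

    meet-left-right : ∀ c c′ → edgePoint (left c) t ≡ edgePoint (right c′) s →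
                      MeetAtEnd 0 (suc (suc c)) 1 (suc (suc c′)) (edgePoint (left c) t)
    meet-left-right c c′ p =
      suc (suc c) , inj₂ refl , inj₂ (cong (suc ∘ suc) c≡c′) , edgePoint-end (left c) (proj₁ ends)
      where
      ends = unit+unit≡two {t} {s} ut us (cong proj₁ p)
      c≡c′ : c ≡ c′
      c≡c′ = height-injective (trans (sym (1*height c (proj₁ ends)))
                                     (trans (cong proj₂ p) (1*height c′ (proj₂ ends))))

    meet-at-spine : ∀ {a} c c′ (e : FanEdge a (suc (suc c))) → t ≡ 1ℚ → height c ≡ height c′ + s →
                    MeetAtEnd a (suc (suc c)) (suc (suc c′)) (suc (suc (suc c′))) (edgePoint e t)
    meet-at-spine c c′ e t≡1 h≡h′+s =
      suc (suc c) , inj₂ refl ,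
      [ (λ c≡c′ → inj₁ (cong (suc ∘ suc) c≡c′)) , (λ c≡1+c′ → inj₂ (cong (suc ∘ suc) c≡1+c′)) ]′
        (spine-vertex us h≡h′+s) ,
      edgePoint-end e t≡1

    meet-left-spine : ∀ c c′ → edgePoint (left c) t ≡ edgePoint (spine c′) s →
                      MeetAtEnd 0 (suc (suc c)) (suc (suc c′)) (suc (suc (suc c′))) (edgePoint (left c) t)
    meet-left-spine c c′ p = meet-at-spine c c′ (left c) (cong proj₁ p)
                               (trans (sym (1*height c (cong proj₁ p))) (cong proj₂ p))

    meet-right-right : ∀ c c′ → c ≢ c′ → edgePoint (right c) t ≡ edgePoint (right c′) s →
                       MeetAtEnd 1 (suc (suc c)) 1 (suc (suc c′)) (edgePoint (right c) t)
    meet-right-right c c′ c≢c′ p = 1 , inj₁ refl , inj₁ refl , edgePoint-start (right c) t≡0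
      where
      t≡0 = t*height-injective {t} c≢c′
              (trans (cong proj₂ p) (cong (_* height c′) (sym (two-minus-injective {t} {s} (cong proj₁ p)))))

    meet-right-spine : ∀ c c′ → edgePoint (right c) t ≡ edgePoint (spine c′) s →
                       MeetAtEnd 1 (suc (suc c)) (suc (suc c′)) (suc (suc (suc c′))) (edgePoint (right c) t)
    meet-right-spine c c′ p = meet-at-spine c c′ (right c) t≡1 (trans (sym (1*height c t≡1)) (cong proj₂ p))
      where
      t≡1 = two-minus≡1 {t} (cong proj₁ p)

    meet-spine-spine : ∀ c c′ → c ≢ c′ → edgePoint (spine c) t ≡ edgePoint (spine c′) s →
                       MeetAtEnd (suc (suc c)) (suc (suc (suc c))) (suc (suc c′)) (suc (suc (suc c′)))
                                 (edgePoint (spine c) t)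
    meet-spine-spine c c′ c≢c′ p = from (same-unit-point (suc (suc c)) (suc (suc c′)) ut us (cong proj₂ p))
      where
      from : SameUnitPoint (suc (suc c)) (suc (suc c′)) t s →
             MeetAtEnd (suc (suc c)) (suc (suc (suc c))) (suc (suc c′)) (suc (suc (suc c′))) (edgePoint (spine c) t)
      from (inj₁ (e , _)) = ⊥-elim (c≢c′ (ℕ.suc-injective (ℕ.suc-injective e)))
      from (inj₂ (inj₁ (e , t≡1 , _))) = suc (suc (suc c)) , inj₂ refl , inj₁ (sym e) , edgePoint-end (spine c) t≡1
      from (inj₂ (inj₂ (e , t≡0 , _))) = suc (suc c) , inj₁ refl , inj₂ e , edgePoint-start (spine c) t≡0

  swapped : ∀ {a b c d} {p q : Point} → p ≡ q → MeetAtEnd c d a b q → MeetAtEnd a b c d p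
  swapped p≡q (w , at-cd , at-ab , q≡w) = w , at-ab , at-cd , trans p≡q q≡w

  meet-edges : ∀ {a b c d t s} (e₁ : FanEdge a b) (e₂ : FanEdge c d) → ¬ (a ≡ c × b ≡ d) →
               0≤ t ≤1 → 0≤ s ≤1 → edgePoint e₁ t ≡ edgePoint e₂ s → MeetAtEnd a b c d (edgePoint e₁ t)
  meet-edges base      base       ne ut us p = ⊥-elim (ne (refl , refl))
  meet-edges base      (left c)   ne ut us p = meet-base-left ut us c p
  meet-edges base      (right c)  ne ut us p = meet-base-right ut us c p
  meet-edges base      (spine c)  ne ut us p = ⊥-elim (meet-base-spine ut us c p)
  meet-edges (left c)  base       ne ut us p = swapped p (meet-base-left us ut c (sym p))
  meet-edges (left c)  (left c′)  ne ut us p = meet-left-left ut us c c′ (λ e → ne (refl , cong (suc ∘ suc) e)) p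
  meet-edges (left c)  (right c′) ne ut us p = meet-left-right ut us c c′ p
  meet-edges (left c)  (spine c′) ne ut us p = meet-left-spine ut us c c′ p
  meet-edges (right c) base       ne ut us p = swapped p (meet-base-right us ut c (sym p))
  meet-edges (right c) (left c′)  ne ut us p = swapped p (meet-left-right us ut c′ c (sym p))
  meet-edges (right c) (right c′) ne ut us p = meet-right-right ut us c c′ (λ e → ne (refl , cong (suc ∘ suc) e)) p
  meet-edges (right c) (spine c′) ne ut us p = meet-right-spine ut us c c′ p
  meet-edges (spine c) base       ne ut us p = ⊥-elim (meet-base-spine us ut c (sym p))
  meet-edges (spine c) (left c′)  ne ut us p = swapped p (meet-left-spine us ut c′ c (sym p))
  meet-edges (spine c) (right c′) ne ut us p = swapped p (meet-right-spine us ut c′ c (sym p))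
  meet-edges (spine c) (spine c′) ne ut us p =
    meet-spine-spine ut us c c′ (λ e → ne (cong (suc ∘ suc) e , cong (suc ∘ suc ∘ suc) e)) p

  meet-on-edges : ∀ {a b c d q} (e₁ : FanEdge a b) (e₂ : FanEdge c d) → ¬ (a ≡ c × b ≡ d) →
                  OnSegment (fanPos a) (fanPos b) q → OnSegment (fanPos c) (fanPos d) q → MeetAtEnd a b c d q
  meet-on-edges {a} {b} {c} {d} e₁ e₂ ne o₁ o₂ =
    let t , ut , q≡p₁ = onFanEdge e₁ o₁
        s , us , q≡p₂ = onFanEdge e₂ o₂
    in subst (MeetAtEnd a b c d) (sym q≡p₁) (meet-edges e₁ e₂ ne ut us (trans (sym q≡p₁) q≡p₂))

  flip₁ : ∀ {a b c d q} → MeetAtEnd b a c d q → MeetAtEnd a b c d q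
  flip₁ (w , at-ba , at-cd , q≡w) = w , Sum.swap at-ba , at-cd , q≡w

  flip₂ : ∀ {a b c d q} → MeetAtEnd a b d c q → MeetAtEnd a b c d q
  flip₂ (w , at-ab , at-dc , q≡w) = w , at-ab , Sum.swap at-dc , q≡w

  fan-meet : ∀ {a b c d q} → FanAdjacent a b → FanAdjacent c d → ¬ (a ≡ c × b ≡ d) → ¬ (a ≡ d × b ≡ c) →
             OnSegment (fanPos a) (fanPos b) q → OnSegment (fanPos c) (fanPos d) q → MeetAtEnd a b c d q
  fan-meet {a} {b} {c} {d} (inj₁ e₁) (inj₁ e₂) ne ne′ o₁ o₂ = meet-on-edges e₁ e₂ ne o₁ o₂
  fan-meet {a} {b} {c} {d} (inj₁ e₁) (inj₂ e₂) ne ne′ o₁ o₂ =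
    flip₂ (meet-on-edges e₁ e₂ ne′ o₁ (OnSegment-sym (fanPos c) (fanPos d) o₂))
  fan-meet {a} {b} {c} {d} (inj₂ e₁) (inj₁ e₂) ne ne′ o₁ o₂ =
    flip₁ (meet-on-edges e₁ e₂ (λ (b≡c , a≡d) → ne′ (a≡d , b≡c))
                         (OnSegment-sym (fanPos a) (fanPos b) o₁) o₂)
  fan-meet {a} {b} {c} {d} (inj₂ e₁) (inj₂ e₂) ne ne′ o₁ o₂ =
    flip₁ (flip₂ (meet-on-edges e₁ e₂ (λ (b≡d , a≡c) → ne (a≡c , b≡d))
                                (OnSegment-sym (fanPos a) (fanPos b) o₁) (OnSegment-sym (fanPos c) (fanPos d) o₂)))

  incident-edge : ∀ z → Σ ℕ (FanAdjacent z)
  incident-edge zero          = 1 , inj₁ base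
  incident-edge (suc zero)    = 0 , inj₂ base
  incident-edge (suc (suc c)) = 0 , inj₂ (left c)

  -- z lies on an edge of its own, which can meet the edge ab only at an end of ab.
  fan-no-vertex-on-edge : ∀ {a b z} → FanAdjacent a b → z ≢ a → z ≢ b →
                          ¬ OnSegment (fanPos a) (fanPos b) (fanPos z)
  fan-no-vertex-on-edge {a} {b} {z} ab z≢a z≢b o =
    let w , zw = incident-edge z
        w′ , _ , at-ab , z≡w′ =
          fan-meet zw ab (z≢a ∘ proj₁) (z≢b ∘ proj₁) (OnSegment-start (fanPos z) (fanPos w)) o
    in [ z≢a ∘ trans (fanPos-injective z≡w′) , z≢b ∘ trans (fanPos-injective z≡w′) ]′ at-ab

  0≤two : 0ℚ ≤ two
  0≤two = <⇒≤ (<-trans 0<1 1<two)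

  fan-edge-right : ∀ {a b q} (e : FanEdge a b) → OnSegment (fanPos a) (fanPos b) q →
                   0ℚ ≤ proj₁ q × (proj₁ q ≡ 0ℚ → q ≡ fanPos 0 × a ≡ 0)
  fan-edge-right {q = q} e o = let t , ut , q≡p = onFanEdge e o in right-of e ut q≡p
    where
    right-of : ∀ {a b t} (e : FanEdge a b) → 0≤ t ≤1 → q ≡ edgePoint e t →
               0ℚ ≤ proj₁ q × (proj₁ q ≡ 0ℚ → q ≡ fanPos 0 × a ≡ 0)
    right-of {t = t} base (0≤t , _) q≡p =
      subst (0ℚ ≤_) (sym (cong proj₁ q≡p)) (0≤p*q 0≤t 0≤two) ,
      λ x≡0 → trans q≡p (edgePoint-start base
                 ([ (λ t≡0 → t≡0) , (λ two≡0 → ⊥-elim (<-irrefl (sym two≡0) (<-trans 0<1 1<two))) ]′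
                    (p*q≡0 {t} {two} (trans (sym (cong proj₁ q≡p)) x≡0)))) , refl
    right-of (left c) (0≤t , _) q≡p =
      subst (0ℚ ≤_) (sym (cong proj₁ q≡p)) 0≤t ,
      λ x≡0 → trans q≡p (edgePoint-start (left c) (trans (sym (cong proj₁ q≡p)) x≡0)) , refl
    right-of {t = t} (right c) (_ , t≤1) q≡p =
      <⇒≤ 0<x , λ x≡0 → ⊥-elim (<-irrefl (sym x≡0) 0<x)
      where
      0<x : 0ℚ < proj₁ q
      0<x = subst (0ℚ <_) (sym (cong proj₁ q≡p))
              (<-≤-trans 0<1 (0≤q-p⇒p≤q (subst (0ℚ ≤_) (solve 1 (λ t → con 1ℚ :- t := con two :- t :- con 1ℚ) refl t)
                                                  (p≤q⇒0≤q-p t≤1))))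
    right-of (spine c) _ q≡p =
      subst (0ℚ ≤_) (sym (cong proj₁ q≡p)) 0≤1 ,
      λ x≡0 → ⊥-elim (<-irrefl (trans (sym x≡0) (cong proj₁ q≡p)) 0<1)

  fan-right : ∀ {a b q} → FanAdjacent a b → OnSegment (fanPos a) (fanPos b) q →
              0ℚ ≤ proj₁ q × (proj₁ q ≡ 0ℚ → q ≡ fanPos 0 × (a ≡ 0 ⊎ b ≡ 0))
  fan-right (inj₁ e) o = let 0≤x , on-axis = fan-edge-right e o in
    0≤x , λ x≡0 → let q≡0 , a≡0 = on-axis x≡0 in q≡0 , inj₁ a≡0
  fan-right {a} {b} (inj₂ e) o = let 0≤x , on-axis = fan-edge-right e (OnSegment-sym (fanPos a) (fanPos b) o) in
    0≤x , λ x≡0 → let q≡0 , b≡0 = on-axis x≡0 in q≡0 , inj₂ b≡0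

  0<fanPos-suc : ∀ c → 0ℚ < proj₁ (fanPos (suc c))
  0<fanPos-suc zero    = <-trans 0<1 1<two
  0<fanPos-suc (suc c) = 0<1

  fan-drawing : ∀ {n} (Gr : Graph n) (ρ : Fin n → ℕ) → (∀ {i j} → ρ i ≡ ρ j → i ≡ j) →
                (∀ {i j} → adj Gr i j ≡ true → FanAdjacent (ρ i) (ρ j)) → PlaneDrawing Gr
  fan-drawing {n} Gr ρ ρ-inj fan = record
    { pos                = fanPos ∘ ρ
    ; pos-inj            = ρ-inj ∘ fanPos-injective
    ; no-vertex-on-edge  = λ u v w uv w≢u w≢v →
        fan-no-vertex-on-edge (fan uv) (w≢u ∘ ρ-inj) (w≢v ∘ ρ-inj)
    ; edges-meet-at-ends = λ u v x y uv xy ne ne′ q o₁ o₂ →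
        at-vertex (fan-meet (fan uv) (fan xy) (ne ∘ both) (ne′ ∘ both) o₁ o₂)
    }
    where
    both : ∀ {u v x y} → ρ u ≡ ρ x × ρ v ≡ ρ y → u ≡ x × v ≡ y
    both (e , e′) = ρ-inj e , ρ-inj e′
    at-vertex : ∀ {u v x y q} → MeetAtEnd (ρ u) (ρ v) (ρ x) (ρ y) q →
                Σ (Fin n) λ w → (w ≡ u ⊎ w ≡ v) × (w ≡ x ⊎ w ≡ y) × q ≡ fanPos (ρ w)
    at-vertex {u} {v} (w , inj₁ w≡u , at-xy , q≡w) =
      u , inj₁ refl , Sum.map (ρ-inj ∘ trans (sym w≡u)) (ρ-inj ∘ trans (sym w≡u)) at-xy ,
      trans q≡w (cong fanPos w≡u)
    at-vertex {u} {v} (w , inj₂ w≡v , at-xy , q≡w) =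
      v , inj₂ refl , Sum.map (ρ-inj ∘ trans (sym w≡v)) (ρ-inj ∘ trans (sym w≡v)) at-xy ,
      trans q≡w (cong fanPos w≡v)

module GluedDrawing {m k : ℕ} {G : Graph m} {v : Fin m} {Q : Graph (suc k)}
                    (DG : PlaneDrawing G) (rightmost : Plane.IsRightmost DG v)
                    (DQ : PlaneDrawing Q) (right : Plane.RightOfOrigin DQ) where
  import Data.Nat.Base as ℕ
  open import Data.Fin.Base using (zero; suc; splitAt)
  import Data.Fin.Properties as Fin
  open import Data.Rational using (_-_; _≤_; _<_)
  open import Data.Rational.Properties using (+-identityʳ; +-inverseʳ; +-monoʳ-<; <-irrefl; ≤-<-trans; ≤-antisym)
  open import Relation.Nullary using (Dec)
  open Plane
  open Glue G v Q
  open Plane.RightOfOrigin right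
  module DG = PlaneDrawing DG
  module DQ = PlaneDrawing DQ

  o : Point
  o = DG.pos v

  posQ : Fin (suc k) → Point
  posQ c = o ⊕ DQ.pos c

  position : Fin (m ℕ.+ k) → Point
  position x = [ DG.pos , posQ ∘ suc ]′ (splitAt m x)

  position-old : ∀ u → position (old u) ≡ DG.pos u
  position-old u rewrite splitAt-old u = refl

  position-fromQ : ∀ c → position (fromQ c) ≡ posQ c
  position-fromQ zero    = trans (position-old v) (trans (sym (⊕-identityʳ o)) (cong (o ⊕_) (sym zero-at-origin)))
  position-fromQ (suc j) rewrite splitAt-new j = refl

  left-of-o : ∀ {u w q} → OnSegment (DG.pos u) (DG.pos w) q → proj₁ q ≤ proj₁ o
  left-of-o {u} {w} (t , 0≤t , t≤1 , ex , _) =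
    subst (_≤ proj₁ o) (sym ex) (convex-≤ (0≤t , t≤1) (rightmost u) (rightmost w))

  right-of-o : ∀ {c d q} → adj Q c d ≡ true → OnSegment (posQ c) (posQ d) q →
               proj₁ o ≤ proj₁ q × (proj₁ q ≡ proj₁ o → q ≡ o × (c ≡ zero ⊎ d ≡ zero))
  right-of-o {c} {d} {q} a seg =
    let 0≤x , on-axis = edges-right c d (q ⊖ o) a (OnSegment-translate o seg)
    in 0≤q-p⇒p≤q 0≤x ,
       λ x≡X → let q⊖o≡0 , at-zero = on-axis (trans (cong (_- proj₁ o) x≡X) (+-inverseʳ (proj₁ o)))
               in trans (sym (⊖-⊕ o q)) (trans (cong (o ⊕_) q⊖o≡0) (⊕-identityʳ o)) , at-zero

  o<new : ∀ j → proj₁ o < proj₁ (posQ (suc j))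
  o<new j = subst (_< proj₁ (posQ (suc j))) (+-identityʳ (proj₁ o)) (+-monoʳ-< (proj₁ o) (others-right j))

  old≢new-position : ∀ u j → DG.pos u ≢ posQ (suc j)
  old≢new-position u j e = <-irrefl (cong proj₁ e) (≤-<-trans (rightmost u) (o<new j))

  position-injective : ∀ {x y} → position x ≡ position y → x ≡ y
  position-injective {x} {y} = go (view x) (view y)
    where
    go : ∀ {x y} → View x → View y → position x ≡ position y → x ≡ y
    go (is-old u) (is-old w) e = cong old (DG.pos-inj (trans (sym (position-old u)) (trans e (position-old w))))
    go (is-old u) (is-new j) e =
      ⊥-elim (old≢new-position u j (trans (sym (position-old u)) (trans e (position-fromQ (suc j)))))
    go (is-new i) (is-old w) e =
      ⊥-elim (old≢new-position w i (trans (sym (position-old w)) (trans (sym e) (position-fromQ (suc i)))))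
    go (is-new i) (is-new j) e = cong new (Fin.suc-injective (DQ.pos-inj (⊕-cancelˡ o
      (trans (sym (position-fromQ (suc i))) (trans e (position-fromQ (suc j)))))))

  OldNotV : Fin (m ℕ.+ k) → Set
  OldNotV z = Σ (Fin m) λ u → u ≢ v × z ≡ old u

  side : ∀ z → OldNotV z ⊎ InQ z
  side z = from-view (view z)
    where
    from-dec : ∀ u → Dec (u ≡ v) → OldNotV (old u) ⊎ InQ (old u)
    from-dec u (yes u≡v) = inj₂ (zero , cong old u≡v)
    from-dec u (no u≢v)  = inj₁ (u , u≢v , refl)
    from-view : ∀ {z} → View z → OldNotV z ⊎ InQ z
    from-view (is-old u) = from-dec u (u Fin.≟ v)
    from-view (is-new j) = inj₂ (suc j , refl)

  v-on-G-edge : ∀ {u w} → adj G u w ≡ true → OnSegment (DG.pos u) (DG.pos w) o → v ≡ u ⊎ v ≡ w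
  v-on-G-edge {u} {w} a seg = by-dec (v Fin.≟ u) (v Fin.≟ w)
    where
    by-dec : Dec (v ≡ u) → Dec (v ≡ w) → v ≡ u ⊎ v ≡ w
    by-dec (yes v≡u) _         = inj₁ v≡u
    by-dec (no _)    (yes v≡w) = inj₂ v≡w
    by-dec (no v≢u)  (no v≢w)  = ⊥-elim (DG.no-vertex-on-edge u w v a v≢u v≢w seg)

  Q-segment : ∀ {c d q} → OnSegment (posQ c) (posQ d) q → OnSegment (DQ.pos c) (DQ.pos d) (q ⊖ o)
  Q-segment = OnSegment-translate o

  no-vertex-on-edge : ∀ x y z → adj glued x y ≡ true → z ≢ x → z ≢ y →
                      ¬ OnSegment (position x) (position y) (position z)
  no-vertex-on-edge x y z a z≢x z≢y = go (glued-edge x y a) (view z) (side z) z≢x z≢y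
    where
    go : ∀ {x y z} → GlueEdge x y → View z → OldNotV z ⊎ InQ z → z ≢ x → z ≢ y →
         ¬ OnSegment (position x) (position y) (position z)
    go (inj₁ (u , w , refl , refl , uw)) (is-old z) _ z≢x z≢y seg =
      DG.no-vertex-on-edge u w z uw (z≢x ∘ cong old) (z≢y ∘ cong old)
        (OnSegment-cong (position-old u) (position-old w) (position-old z) seg)
    go (inj₁ (u , w , refl , refl , uw)) (is-new j) _ _ _ seg =
      <-irrefl refl (≤-<-trans (left-of-o (OnSegment-cong (position-old u) (position-old w)
                                              (position-fromQ (suc j)) seg)) (o<new j))
    go (inj₂ (c , d , refl , refl , cd)) _ (inj₁ (z , z≢v , refl)) _ _ seg =
      z≢v (DG.pos-inj (proj₁ (proj₂ (right-of-o cd seg′)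
             (≤-antisym (rightmost z) (proj₁ (right-of-o cd seg′))))))
      where
      seg′ = OnSegment-cong (position-fromQ c) (position-fromQ d) (position-old z) seg
    go (inj₂ (c , d , refl , refl , cd)) _ (inj₂ (e , refl)) z≢x z≢y seg =
      DQ.no-vertex-on-edge c d e cd (z≢x ∘ cong fromQ) (z≢y ∘ cong fromQ)
        (subst (OnSegment (DQ.pos c) (DQ.pos d)) (⊕-⊖ o (DQ.pos e))
          (Q-segment (OnSegment-cong (position-fromQ c) (position-fromQ d) (position-fromQ e) seg)))

  MeetAtEnd : (x₁ x₂ x₃ x₄ : Fin (m ℕ.+ k)) → Point → Set
  MeetAtEnd x₁ x₂ x₃ x₄ q = Σ (Fin (m ℕ.+ k)) λ w → (w ≡ x₁ ⊎ w ≡ x₂) × (w ≡ x₃ ⊎ w ≡ x₄) × q ≡ position w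

  -- A G-edge lies weakly left of o and a Q-edge weakly right of it, so they can only share the point o.
  mixed-meet : ∀ {u w c d q} → adj G u w ≡ true → adj Q c d ≡ true →
               OnSegment (DG.pos u) (DG.pos w) q → OnSegment (posQ c) (posQ d) q →
               MeetAtEnd (old u) (old w) (fromQ c) (fromQ d) q
  mixed-meet {u} {w} uw cd seg seg′ =
    let o≤x , on-axis = right-of-o cd seg′
        q≡o , at-zero = on-axis (≤-antisym (left-of-o seg) o≤x)
    in old v ,
       Sum.map (cong old) (cong old) (v-on-G-edge uw (OnSegment-cong {a = DG.pos u} {b = DG.pos w} refl refl q≡o seg)) ,
       Sum.map (λ c≡0 → cong fromQ (sym c≡0)) (λ d≡0 → cong fromQ (sym d≡0)) at-zero ,
       trans q≡o (sym (position-old v))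

  edges-meet-at-ends : ∀ x₁ x₂ x₃ x₄ → adj glued x₁ x₂ ≡ true → adj glued x₃ x₄ ≡ true →
                       ¬ (x₁ ≡ x₃ × x₂ ≡ x₄) → ¬ (x₁ ≡ x₄ × x₂ ≡ x₃) → ∀ q →
                       OnSegment (position x₁) (position x₂) q → OnSegment (position x₃) (position x₄) q →
                       MeetAtEnd x₁ x₂ x₃ x₄ q
  edges-meet-at-ends x₁ x₂ x₃ x₄ a₁₂ a₃₄ ne ne′ q =
    go (glued-edge x₁ x₂ a₁₂) (glued-edge x₃ x₄ a₃₄) ne ne′
    where
    both : ∀ {A : Set} {a b c d : A} (f : A → Fin (m ℕ.+ k)) → a ≡ c × b ≡ d → f a ≡ f c × f b ≡ f d
    both f (e , e′) = cong f e , cong f e′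
    go : ∀ {x₁ x₂ x₃ x₄} → GlueEdge x₁ x₂ → GlueEdge x₃ x₄ →
         ¬ (x₁ ≡ x₃ × x₂ ≡ x₄) → ¬ (x₁ ≡ x₄ × x₂ ≡ x₃) →
         OnSegment (position x₁) (position x₂) q → OnSegment (position x₃) (position x₄) q →
         MeetAtEnd x₁ x₂ x₃ x₄ q
    go (inj₁ (u₁ , u₂ , refl , refl , a)) (inj₁ (u₃ , u₄ , refl , refl , a′)) ne ne′ seg seg′ =
      let w , at₁₂ , at₃₄ , q≡w = DG.edges-meet-at-ends u₁ u₂ u₃ u₄ a a′ (ne ∘ both old) (ne′ ∘ both old) q
                                    (OnSegment-cong (position-old u₁) (position-old u₂) (refl {x = q}) seg)
                                    (OnSegment-cong (position-old u₃) (position-old u₄) (refl {x = q}) seg′)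
      in old w , Sum.map (cong old) (cong old) at₁₂ , Sum.map (cong old) (cong old) at₃₄ ,
         trans q≡w (sym (position-old w))
    go (inj₂ (c₁ , c₂ , refl , refl , a)) (inj₂ (c₃ , c₄ , refl , refl , a′)) ne ne′ seg seg′ =
      let w , at₁₂ , at₃₄ , q≡w = DQ.edges-meet-at-ends c₁ c₂ c₃ c₄ a a′ (ne ∘ both fromQ) (ne′ ∘ both fromQ) (q ⊖ o)
                                    (Q-segment (OnSegment-cong (position-fromQ c₁) (position-fromQ c₂) (refl {x = q}) seg))
                                    (Q-segment (OnSegment-cong (position-fromQ c₃) (position-fromQ c₄) (refl {x = q}) seg′))
      in fromQ w , Sum.map (cong fromQ) (cong fromQ) at₁₂ , Sum.map (cong fromQ) (cong fromQ) at₃₄ ,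
         trans (sym (⊖-⊕ o q)) (trans (cong (o ⊕_) q≡w) (sym (position-fromQ w)))
    go (inj₁ (u₁ , u₂ , refl , refl , a)) (inj₂ (c₃ , c₄ , refl , refl , a′)) _ _ seg seg′ =
      mixed-meet a a′ (OnSegment-cong (position-old u₁) (position-old u₂) (refl {x = q}) seg)
                      (OnSegment-cong (position-fromQ c₃) (position-fromQ c₄) (refl {x = q}) seg′)
    go (inj₂ (c₁ , c₂ , refl , refl , a)) (inj₁ (u₃ , u₄ , refl , refl , a′)) _ _ seg seg′ =
      let w , at₃₄ , at₁₂ , q≡w = mixed-meet a′ a (OnSegment-cong (position-old u₃) (position-old u₄) (refl {x = q}) seg′)
                                                  (OnSegment-cong (position-fromQ c₁) (position-fromQ c₂) (refl {x = q}) seg)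
      in w , at₁₂ , at₃₄ , q≡w

  drawing : PlaneDrawing glued
  drawing = record
    { pos                = position
    ; pos-inj            = position-injective
    ; no-vertex-on-edge  = no-vertex-on-edge
    ; edges-meet-at-ends = edges-meet-at-ends
    }

module Gadget where
  open import Data.Nat.Base using (_+_; _*_; _∸_; _≤_; _<_; _<ᵇ_; _≡ᵇ_; z≤n; s≤s)
  import Data.Nat.Properties as ℕ
  open import Data.Nat.Solver using (module +-*-Solver)
  open +-*-Solver
  open import Data.Fin.Base using (zero; suc)
  open import Data.Fin.Patterns using (0F; 1F; 2F; 3F; 4F)
  import Data.Fin.Properties as Fin
  open import Data.Bool.Base using (_∧_; _∨_; if_then_else_; T)
  open import Data.Bool.Properties using (∨-comm; ∧-zeroʳ)
  open import Relation.Nullary using (Dec)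
  open import Relation.Nullary.Decidable using (dec-false)
  open Counting
  open Cycles
  open Fan using (FanEdge; FanAdjacent; base; left; right; spine)

  -- The edges cd, c < d, of the gadget for k = 3 + r.
  upper : ℕ → ℕ → ℕ → Bool
  upper r 0 d = 0 <ᵇ d
  upper r 1 d = 3 <ᵇ d
  upper r 2 d = (d ≡ᵇ 3) ∧ (0 <ᵇ r)
  upper r 3 d = false
  upper r (suc (suc (suc (suc c)))) d = d ≡ᵇ 5 + c

  upper-irrefl : ∀ r c → upper r c c ≡ false
  upper-irrefl r 0 = refl
  upper-irrefl r 1 = refl
  upper-irrefl r 2 = refl
  upper-irrefl r 3 = refl
  upper-irrefl r (suc (suc (suc (suc c)))) = n≡ᵇ1+n c
    where
    n≡ᵇ1+n : ∀ n → (n ≡ᵇ suc n) ≡ false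
    n≡ᵇ1+n zero    = refl
    n≡ᵇ1+n (suc n) = n≡ᵇ1+n n

  ≡ᵇ-true : ∀ {d e} → (d ≡ᵇ e) ≡ true → d ≡ e
  ≡ᵇ-true {d} {e} eq = ℕ.≡ᵇ⇒≡ d e (subst T (sym eq) _)

  ∨-true : ∀ {x y} → x ∨ y ≡ true → x ≡ true ⊎ y ≡ true
  ∨-true {true}  _ = inj₁ refl
  ∨-true {false} e = inj₂ e

  gadget : ∀ r → Graph (4 + r)
  gadget r = record
    { adj   = λ i j → upper r (toℕ i) (toℕ j) ∨ upper r (toℕ j) (toℕ i)
    ; sym   = λ i j → ∨-comm (upper r (toℕ i) (toℕ j)) (upper r (toℕ j) (toℕ i))
    ; irref = λ i → cong (λ b → b ∨ b) (upper-irrefl r (toℕ i))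
    }

  upper⇒FanEdge : ∀ r c d → upper r c d ≡ true → FanEdge c d
  upper⇒FanEdge r 0 1                         _ = base
  upper⇒FanEdge r 0 (suc (suc d))             _ = left d
  upper⇒FanEdge r 1 (suc (suc (suc (suc d)))) _ = right (suc (suc d))
  upper⇒FanEdge r 2 3                         _ = spine 0
  upper⇒FanEdge r (suc (suc (suc (suc c)))) d e =
    subst (FanEdge _) (sym (≡ᵇ-true {d} {5 + c} e)) (spine (suc (suc c)))

  gadget-fan : ∀ r {i j} → adj (gadget r) i j ≡ true → FanAdjacent (toℕ i) (toℕ j)
  gadget-fan r {i} {j} e =
    Sum.map (upper⇒FanEdge r (toℕ i) (toℕ j)) (upper⇒FanEdge r (toℕ j) (toℕ i)) (∨-true e)

  gadget-drawing : ∀ r → PlaneDrawing (gadget r)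
  gadget-drawing r = Fan.fan-drawing (gadget r) toℕ Fin.toℕ-injective (gadget-fan r)

  gadget-right : ∀ r → Plane.RightOfOrigin (gadget-drawing r)
  gadget-right r = record
    { zero-at-origin = refl
    ; others-right   = λ j → Fan.0<fanPos-suc (toℕ j)
    ; edges-right    = λ c d q cd seg →
        let 0≤x , on-axis = Fan.fan-right (gadget-fan r cd) seg
        in 0≤x , λ x≡0 → let q≡0 , end = on-axis x≡0 in q≡0 , Sum.map at-zero at-zero end
    }
    where
    at-zero : ∀ {c : Fin (4 + r)} → toℕ c ≡ 0 → c ≡ zero
    at-zero = Fin.toℕ-injective

  third-block : ℕ → ℕ
  third-block zero    = 3
  third-block (suc _) = 2

  -- The blocks of the gadget minus vertex 0 are {1, 4, …} and {2, 3} when r > 0, and {1}, {2}, {3} when r = 0.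
  block : ℕ → ℕ → ℕ
  block r 2 = 2
  block r 3 = third-block r
  block r _ = 1

  upper-within-block : ∀ r c d → upper r c d ≡ true → c ≢ 0 → block r c ≡ block r d
  upper-within-block r 0 d _ c≢0 = ⊥-elim (c≢0 refl)
  upper-within-block r 1 (suc (suc (suc (suc d)))) _ _ = refl
  upper-within-block zero    2 d e _ = ⊥-elim (false≢true (trans (sym (∧-zeroʳ (d ≡ᵇ 3))) e))
  upper-within-block (suc r) 2 3 _ _ = refl
  upper-within-block r (suc (suc (suc (suc c)))) d e _ = sym (cong (block r) (≡ᵇ-true {d} {5 + c} e))

  gadget-separates : ∀ r x y → adj (gadget r) x y ≡ true → x ≢ zero → y ≢ zero →
                     block r (toℕ x) ≡ block r (toℕ y)
  gadget-separates r x y e x≢0 y≢0 =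
    [ (λ xy → upper-within-block r (toℕ x) (toℕ y) xy (x≢0 ∘ Fin.toℕ-injective))
    , (λ yx → sym (upper-within-block r (toℕ y) (toℕ x) yx (y≢0 ∘ Fin.toℕ-injective))) ]′ (∨-true e)

  third-block≢1 : ∀ r → third-block r ≢ 1
  third-block≢1 zero    ()
  third-block≢1 (suc r) ()

  OutsideBlockOf : ∀ r → Fin (4 + r) → Fin (4 + r) → Set
  OutsideBlockOf r x a = a ≢ zero × block r (toℕ a) ≢ block r (toℕ x)

  two-outside-block : ∀ r (x : Fin (4 + r)) → x ≢ zero →
                      Σ (Fin (4 + r)) λ a → Σ (Fin (4 + r)) λ b →
                      a ≢ b × OutsideBlockOf r x a × OutsideBlockOf r x b
  two-outside-block r       0F x≢0 = ⊥-elim (x≢0 refl)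
  two-outside-block r       1F _ = 2F , 3F , (λ ()) , ((λ ()) , (λ ())) , ((λ ()) , third-block≢1 r)
  two-outside-block zero    2F _ = 1F , 3F , (λ ()) , ((λ ()) , (λ ())) , ((λ ()) , (λ ()))
  two-outside-block (suc r) 2F _ = 1F , 4F , (λ ()) , ((λ ()) , (λ ())) , ((λ ()) , (λ ()))
  two-outside-block zero    3F _ = 1F , 2F , (λ ()) , ((λ ()) , (λ ())) , ((λ ()) , (λ ()))
  two-outside-block (suc r) 3F _ = 1F , 4F , (λ ()) , ((λ ()) , (λ ())) , ((λ ()) , (λ ()))
  two-outside-block r (suc (suc (suc (suc _)))) _ =
    2F , 3F , (λ ()) , ((λ ()) , (λ ())) , ((λ ()) , third-block≢1 r)

  -- A cycle through the cut vertex 0 stays in one block, and misses two vertices outside it.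
  gadget-cycle-free : ∀ r → ¬ ContainsCycle (3 + r) (gadget r)
  gadget-cycle-free r C@(f , f-inj , _) =
    let p , fp≢0 = off-zero (f 0F Fin.≟ zero)
        a , b , a≢b , a-out , b-out = two-outside-block r (f p) fp≢0
    in ℕ.1+n≰n (injection-avoiding-two f f-inj a≢b (misses p fp≢0 a a-out) (misses p fp≢0 b b-out))
    where
    off-zero : Dec (f 0F ≡ zero) → Σ (Fin (3 + r)) λ p → f p ≢ zero
    off-zero (no f0≢0)  = 0F , f0≢0
    off-zero (yes f0≡0) = 1F , λ f1≡0 → 0F≢1F (f-inj (trans f0≡0 (sym f1≡0)))
      where
      0F≢1F : _≡_ {A = Fin (3 + r)} 0F 1F → ⊥
      0F≢1F ()
    misses : ∀ p → f p ≢ zero → ∀ a → OutsideBlockOf r (f p) a → ∀ i → f i ≢ a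
    misses p fp≢0 a (a≢0 , a-out) i refl =
      a-out (cycle-monochromatic (gadget r) zero (block r ∘ toℕ) (gadget-separates r) C i p a≢0 fp≢0)

  <ᵇ⇒< : ∀ {a b} → (a <ᵇ b) ≡ true → a < b
  <ᵇ⇒< {a} {b} e = ℕ.<ᵇ⇒< a b (subst T (sym e) _)

  upper-< : ∀ r c d → upper r c d ≡ true → c < d
  upper-< r 0 d e = <ᵇ⇒< e
  upper-< r 1 (suc (suc (suc (suc d)))) _ = s≤s (s≤s z≤n)
  upper-< r 2 3 _ = ℕ.≤-refl
  upper-< r (suc (suc (suc (suc c)))) d e = subst (suc (suc (suc (suc c))) <_) (sym (≡ᵇ-true {d} {5 + c} e)) ℕ.≤-refl

  upper-edge : ∀ r c d → (upper r c d ∨ upper r d c) ∧ (c <ᵇ d) ≡ upper r c d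
  upper-edge r c d with upper r c d in cd
  ... | true = <⇒<ᵇ≡true (upper-< r c d cd)
  ... | false with upper r d c in dc
  ...   | true  = dec-false (c ℕ.<? d) (ℕ.<⇒≯ (upper-< r d c dc))
  ...   | false = refl

  row : ℕ → ℕ → ℕ
  row r c = ∑[ d < 4 + r ] (if upper r c (toℕ d) then 1 else 0)

  path-rows : ∀ r → ∑[ e < r ] row r (4 + toℕ e) ≡ r ∸ 1
  path-rows r = trans (sum-cong-≗ {r} (λ e → sum-point (4 + r) (5 + toℕ e))) (count r)
    where
    count : ∀ r → ∑[ e < r ] (if 5 + toℕ e <ᵇ 4 + r then 1 else 0) ≡ r ∸ 1
    count zero    = refl
    count (suc r) = sum-below-last r

  gadget-edgeCount : ∀ r → edgeCount (gadget r) ≡ 3 * (3 + r) ∸ 6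
  gadget-edgeCount r = begin
    edgeCount (gadget r)
      ≡⟨ edgeCount-∑ (gadget r) ⟩
    ∑[ i < 4 + r ] ∑[ j < 4 + r ] upperEdge (gadget r) i j
      ≡⟨ sum-cong-≗ {4 + r} (λ i → sum-cong-≗ {4 + r} (λ j →
           cong (if_then 1 else 0) (upper-edge r (toℕ i) (toℕ j)))) ⟩
    ∑[ c < 4 + r ] row r (toℕ c)
      ≡⟨ cong₂ _+_ row-0 (cong₂ _+_ row-1 (cong₂ _+_ row-2 (cong₂ _+_ row-3 (path-rows r)))) ⟩
    (3 + r) + (r + ((if 0 <ᵇ r then 1 else 0) + (0 + (r ∸ 1))))
      ≡⟨ total r ⟩
    3 * (3 + r) ∸ 6 ∎
    where
    open ≡-Reasoning
    row-0 : row r 0 ≡ 3 + r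
    row-0 = sum-ones (3 + r)
    row-1 : row r 1 ≡ r
    row-1 = sum-ones r
    row-3 : row r 3 ≡ 0
    row-3 = sum-replicate-zero (4 + r)
    row-2 : row r 2 ≡ (if 0 <ᵇ r then 1 else 0)
    row-2 = trans (cong ((if 0 <ᵇ r then 1 else 0) +_) (sum-replicate-zero r)) (ℕ.+-identityʳ _)
    total : ∀ r → (3 + r) + (r + ((if 0 <ᵇ r then 1 else 0) + (0 + (r ∸ 1)))) ≡ 3 * (3 + r) ∸ 6
    total zero    = refl
    total (suc r) = sym (cong (_∸ 6) (solve 1 (λ r → con 3 :* (con 4 :+ r) :=
                                                 con 6 :+ ((con 4 :+ r) :+ ((con 1 :+ r) :+ (con 1 :+ r)))) refl r))

open import Data.Nat using (ℕ; _+_; _*_; _∸_; _≤_; _<_; z≤n; s≤s)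
import Data.Nat.Properties as ℕ
open import Data.Fin.Base using (fromℕ<)
open Glue using (glued; glued-cycle; glued-edgeCount)
open Gadget using (gadget; gadget-drawing; gadget-right; gadget-cycle-free; gadget-edgeCount)

lemma3p1 : ∀ (n k : ℕ) → 3 ≤ k → 2 * k + 1 ≤ n →
    ∀ (a b : ℕ) → IsExP n k a → IsExP (n ∸ k) k b →
    b + (3 * k ∸ 6) ≤ a
lemma3p1 n k (s≤s (s≤s (s≤s {n = r} z≤n))) 2k+1≤n a b (_ , maximal) ((G , DG , G-free , refl) , _) = begin
  edgeCount G + (3 * k ∸ 6)           ≡⟨ cong (edgeCount G +_) (sym (gadget-edgeCount r)) ⟩
  edgeCount G + edgeCount (gadget r)  ≤⟨ glued-edgeCount G v (gadget r) ⟩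
  edgeCount H                         ≤⟨ maximal′ H H-planar H-free ⟩
  a                                   ∎
  where
  open ℕ.≤-Reasoning
  k<n : k < n
  k<n = ℕ.<-≤-trans (s≤s (ℕ.m≤m+n k (k + 0))) (subst (_≤ n) (ℕ.+-comm (2 * k) 1) 2k+1≤n)
  v-rightmost : Σ (Fin (n ∸ k)) (Plane.IsRightmost DG)
  v-rightmost = Plane.rightmost-vertex DG (fromℕ< (ℕ.m<n⇒0<n∸m k<n))
  v : Fin (n ∸ k)
  v = proj₁ v-rightmost
  H : Graph (n ∸ k + k)
  H = glued G v (gadget r)
  H-planar : Planar H
  H-planar = GluedDrawing.drawing DG (proj₂ v-rightmost) (gadget-drawing r) (gadget-right r)
  H-free : ¬ ContainsCycle k H
  H-free C = [ G-free , gadget-cycle-free r ]′ (glued-cycle G v (gadget r) k C)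
  maximal′ : ∀ (H : Graph (n ∸ k + k)) → Planar H → ¬ ContainsCycle k H → edgeCount H ≤ a
  maximal′ = subst (λ N → ∀ (H : Graph N) → Planar H → ¬ ContainsCycle k H → edgeCount H ≤ a)
                   (sym (ℕ.m∸n+n≡m (ℕ.<⇒≤ k<n))) maximal
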